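{- Let $q=ef+1$ be a prime power with $q\equiv1\pmod4$, $e>2$ even and $f>1$. Let ${C_0^2}'=\{C_0^e,C_2^e,\ldots,C_{e-2}^e\}$. If either (i) $q\equiv1\pmod8$ and $f\equiv2\pmod4$, or (ii) $f\equiv3\pmod4$, then ${C_0^2}'$ is a proper $(q,\frac{e}{2},f,\phi_0,\phi_1)$-disjoint partial difference family and a proper $(q,\frac{e}{2},f,\frac{q-5}{4}-\phi_0,\frac{q-1}{4}-\phi_1)$-external partial difference family.
   Context: $G=(GF(q),+)$, $G^*=G\setminus\{0\}$; $\alpha$ a primitive element; $C_i^d=\alpha^i\langle\alpha^d\rangle$ for $d\mid q-1$ (so $C_0^2$ is the set of nonzero squares). For $i\in\{0,1\}$, $\Phi_i=\{x\in C_0^e:x\neq1,\ x-1\in\alpha^iC_0^2\}$ and $\phi_i=|\Phi_i|$. $\Delta(D)$ is the multiset $\{x-y:x,y\in D,x\neq y\}$, $\Delta(D_1,D_2)$ the multiset $\{x-y:x\in D_1,y\in D_2\}$, $\lambda A$ is $\lambda$ copies of each element of $A$. For a family of $m$ disjoint $k$-subsets $D_i$ of $G^*$ with union $S$: $(q,m,k,\lambda,\mu)$-disjoint (resp. external) partial difference family means $\bigcup_i\Delta(D_i)$ (resp. $\bigcup_{i\neq j}\Delta(D_i,D_j)$) equals $\lambda S+\mu(G^*\setminus S)$; proper means $\lambda\neq\mu$. -}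

module Defs where

open import Level using (0ℓ)
open import Data.Nat as ℕ using (ℕ; zero; suc; _∸_; _/_; _%_)
open import Data.Nat.Primality using (Prime)
open import Data.Integer as ℤ using (ℤ)
open import Data.Fin using (Fin)
import Data.Fin.Properties as FinP
open import Data.List using (List; []; _∷_; length; map; concatMap; filter; upTo; allFin)
open import Data.List.Relation.Unary.All using (All)
open import Data.List.Relation.Unary.Unique.Propositional using (Unique)
open import Data.List.Membership.Propositional using (_∈_; _∉_)
open import Data.List.Membership.DecPropositional using () renaming (_∈?_ to ∈?-gen)
open import Data.Product using (Σ; ∃; _×_; _,_)
open import Relation.Nullary using (¬_; Dec; yes; no)
open import Relation.Binary.PropositionalEquality using (_≡_; _≢_)
open import Relation.Binary.Definitions using (DecidableEquality)
open import Algebra.Structures using (IsCommutativeRing)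

record FiniteField : Set₁ where
  infixl 6 _+_ _-_
  infixl 7 _*_
  field
    F       : Set
    _≟_     : DecidableEquality F
    _+_ _*_ : F → F → F
    -_      : F → F
    0# 1#   : F
    isCommutativeRing : IsCommutativeRing _≡_ _+_ _*_ -_ 0# 1#
    0≢1     : 0# ≢ 1#
    inverse : ∀ x → x ≢ 0# → ∃ λ y → x * y ≡ 1#
    elems   : List F
    elems-unique   : Unique elems
    elems-complete : ∀ x → x ∈ elems

  _-_ : F → F → F
  x - y = x + (- y)

  order : ℕ
  order = length elems

  _^_ : F → ℕ → F
  x ^ zero  = 1#
  x ^ suc n = x * (x ^ n)

  IsPrimitive : F → Set
  IsPrimitive α = α ≢ 0# × (∀ x → x ≢ 0# → ∃ λ i → α ^ i ≡ x)

  _∈?_ : (x : F) (xs : List F) → Dec (x ∈ xs)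
  _∈?_ = ∈?-gen _≟_

  count : F → List F → ℕ
  count g xs = length (filter (g ≟_) xs)

  -- cyclotomic class C_i^d = α^i ⟨α^d⟩, as the list of its elements
  -- α^(i + d k) for k ≥ 0 with d k < q - 1, i.e. k = 0, …, (q-1)/d - 1
  -- (for d ∣ q-1)
  C : F → (d i : ℕ) → List F
  C α d i = map (λ k → α ^ (i ℕ.+ d ℕ.* k))
                (filter (λ k → d ℕ.* k ℕ.<? (order ∸ 1)) (upTo (order ∸ 1)))

  -- Φ_i = { x ∈ C_0^e : x ≠ 1, x - 1 ∈ α^i C_0^2 },  φ_i = |Φ_i|
  -- (α^i C_0^2 = C_i^2)
  φ : F → (e i : ℕ) → ℕ
  φ α e i = length (filter (λ x → ¬? (x ≟ 1#) ×-dec ((x - 1#) ∈? C α 2 i)) (C α e 0))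
    where
    open import Relation.Nullary using (¬?)
    open import Relation.Nullary.Decidable using (_×-dec_)

  Δ : List F → List F
  Δ D = concatMap (λ x → concatMap (λ y → diff x y) D) D
    where
    diff : F → F → List F
    diff x y with x ≟ y
    ... | yes _ = []
    ... | no  _ = (x - y) ∷ []

  Δ₂ : List F → List F → List F
  Δ₂ D₁ D₂ = concatMap (λ x → map (λ y → x - y) D₂) D₁

  InUnion : {m : ℕ} → (Fin m → List F) → F → Set
  InUnion D x = ∃ λ i → x ∈ D i

  IsFamily : (m k : ℕ) → (Fin m → List F) → Set
  IsFamily m k D =
      (∀ i → Unique (D i) × length (D i) ≡ k × All (_≢ 0#) (D i))
    × (∀ i j → i ≢ j → ∀ x → x ∈ D i → x ∉ D j)

  -- the multiset M equals λ S + μ (G* ∖ S), S the union of the family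
  MultisetEq : {m : ℕ} → (Fin m → List F) → List F → ℤ → ℤ → Set
  MultisetEq D M lam mu =
      (count 0# M ≡ 0)
    × (∀ g → g ≢ 0# → InUnion D g → ℤ.+ (count g M) ≡ lam)
    × (∀ g → g ≢ 0# → ¬ InUnion D g → ℤ.+ (count g M) ≡ mu)

  ΔDisj : {m : ℕ} → (Fin m → List F) → List F
  ΔDisj {m} D = concatMap (λ i → Δ (D i)) (allFin m)

  ΔExt : {m : ℕ} → (Fin m → List F) → List F
  ΔExt {m} D = concatMap (λ i → concatMap (λ j → pair i j) (allFin m)) (allFin m)
    where
    pair : Fin m → Fin m → List F
    pair i j with i FinP.≟ j
    ... | yes _ = []
    ... | no  _ = Δ₂ (D i) (D j)

  IsDisjointPDF : (m k : ℕ) → ℤ → ℤ → (Fin m → List F) → Set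
  IsDisjointPDF m k lam mu D = IsFamily m k D × MultisetEq D (ΔDisj D) lam mu

  IsExternalPDF : (m k : ℕ) → ℤ → ℤ → (Fin m → List F) → Set
  IsExternalPDF m k lam mu D = IsFamily m k D × MultisetEq D (ΔExt D) lam mu

  IsProperDisjointPDF : (m k : ℕ) → ℤ → ℤ → (Fin m → List F) → Set
  IsProperDisjointPDF m k lam mu D = IsDisjointPDF m k lam mu D × lam ≢ mu

  IsProperExternalPDF : (m k : ℕ) → ℤ → ℤ → (Fin m → List F) → Set
  IsProperExternalPDF m k lam mu D = IsExternalPDF m k lam mu D × lam ≢ mu

IsPrimePower : ℕ → Set
IsPrimePower q = ∃ λ p → ∃ λ n → Prime p × 1 ℕ.≤ n × q ≡ p ℕ.^ n

-- The blocks C_{2j}^e together make up the nonzero squares. For g in the quadratic class c,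
-- the pairs (x, y) of one block with x - y = g correspond, via t = x/y, to Φ_c; all pairs of
-- squares with x - y = g correspond to the squares y with y + g a square, and their number is
-- a cyclotomic number of order 2, namely (q-5)/4 or (q-1)/4. Properness is a parity argument:
-- φ₀ + φ₁ = f - 1, and t ↦ t⁻¹ is an involution of Φ_c whose only possible fixed point is -1,
-- which lies in C_0^e exactly when f is even, and then in Φ_0 when 2 is a square (q ≡ 1 mod 8).
module Submission where

open import Defs
open import Data.Nat as ℕ using (ℕ; zero; suc; _≤_; _<_; z≤n; s≤s; NonZero; _%_; _/_)
import Data.Nat.Properties as ℕP
open import Data.Nat.Induction using (<-wellFounded)
open import Induction.WellFounded using (Acc; acc)
open import Data.Integer as ℤ using (ℤ)
import Data.Integer.Properties as ℤP
open import Data.Fin as Fin using (Fin; toℕ)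
import Data.Fin.Properties as FinP
open import Data.Nat.DivMod
  using (m≡m%n+[m/n]*n; m%n<n; m%n%n≡m%n; m∣n⇒o%n%m≡o%m; [m+kn]%n≡m%n; m<n⇒m%n≡m; m*n%n≡0; m*n/n≡m;
         %-distribˡ-+; %-distribˡ-*)
open import Data.Nat.Divisibility using (_∣_; divides)
open import Data.List using (List; []; _∷_; length; map; filter; concatMap; deduplicate; lookup; upTo; allFin; cartesianProduct; _++_)
open import Data.List.Properties using (length-++; length-map; map-++; map-∘; concatMap-cong; map-concatMap; filter-none; length-filter; length-deduplicate; length-upTo)
open import Data.List.Relation.Unary.Any using (here; there; index)
open import Data.List.Relation.Unary.Any.Properties using (lookup-index)
import Data.List.Relation.Unary.All as All
open import Data.List.Relation.Unary.AllPairs using ([]; _∷_)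
open import Data.List.Relation.Unary.Unique.Propositional using (Unique)
import Data.List.Relation.Unary.Unique.Propositional.Properties as Unique
open import Data.List.Membership.Propositional using (_∈_; _∉_; find; lose)
open import Data.List.Membership.Propositional.Properties
  using (∈-filter⁺; ∈-filter⁻; ∈-map⁺; ∈-map⁻; ∈-upTo⁺; ∈-upTo⁻; ∈-++⁺ˡ; ∈-++⁺ʳ; ∈-++⁻; ∈-allFin;
         ∈-cartesianProduct⁺; ∈-cartesianProduct⁻; ∈-concatMap⁺; ∈-concatMap⁻; ∈-deduplicate⁺)
open import Data.List.Membership.Propositional.Properties.WithK using (unique∧set⇒bag)
open import Data.List.Relation.Binary.BagAndSetEquality using (∼bag⇒↭)
open import Data.List.Relation.Binary.Permutation.Propositional.Properties using (↭-length)
open import Data.Product using (∃; ∃₂; _×_; _,_; proj₁; proj₂)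
open import Data.Sum using (_⊎_; inj₁; inj₂; [_,_]′)
open import Data.Empty using (⊥; ⊥-elim)
open import Function using (id; _∘_; _⇔_; mk⇔)
open import Relation.Nullary using (¬_; Dec; yes; no; ¬?)
open import Relation.Nullary.Decidable using (_×-dec_)
open import Relation.Binary.Definitions using (DecidableEquality; tri<; tri≈; tri>)
open import Relation.Unary using (Decidable)
open import Relation.Binary.PropositionalEquality
  using (_≡_; _≢_; refl; sym; trans; cong; cong₂; subst; subst₂; module ≡-Reasoning)
open import Algebra.Structures using (IsCommutativeRing)
open import Algebra.Bundles using (CommutativeRing)
import Algebra.Properties.Ring as RingProperties
import Algebra.Properties.AbelianGroup as AbelianGroupProperties
open import Tactic.RingSolver.Core.AlmostCommutativeRing using (fromCommutativeRing)
open import Data.Maybe using (nothing)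
open import Data.Integer.Tactic.RingSolver using (solve-∀)

m+m≡m*2 : ∀ m → m ℕ.+ m ≡ m ℕ.* 2
m+m≡m*2 m = trans (cong (m ℕ.+_) (sym (ℕP.+-identityʳ m))) (ℕP.*-comm 2 m)

m∸1≡r+[m/d]*d : ∀ {m d r} .{{_ : NonZero d}} → m % d ≡ suc r → m ℕ.∸ 1 ≡ r ℕ.+ (m / d) ℕ.* d
m∸1≡r+[m/d]*d {m} {d} m%d≡1+r = cong (ℕ._∸ 1) (trans (m≡m%n+[m/n]*n m d) (cong (ℕ._+ (m / d) ℕ.* d) m%d≡1+r))

m%4≡r⇒m%2≡r%2 : ∀ {m r} → m % 4 ≡ r → m % 2 ≡ r % 2
m%4≡r⇒m%2≡r%2 {m} m%4≡r = trans (sym (m∣n⇒o%n%m≡o%m 2 4 m (divides 2 refl))) (cong (_% 2) m%4≡r)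

private
  m+m≢1+n+n : ∀ m n → m ℕ.+ m ≢ suc (n ℕ.+ n)
  m+m≢1+n+n m n eq = ℕP.0≢1+n (begin
    0                    ≡⟨ m*n%n≡0 m 2 ⟨
    m ℕ.* 2 % 2          ≡⟨ cong (_% 2) (trans (sym (m+m≡m*2 m)) (trans eq (cong suc (m+m≡m*2 n)))) ⟩
    (1 ℕ.+ n ℕ.* 2) % 2  ≡⟨ [m+kn]%n≡m%n 1 n 2 ⟩
    1                    ∎)
    where open ≡-Reasoning

  m+m≡n+n⇒m≡n : ∀ {m n} → m ℕ.+ m ≡ n ℕ.+ n → m ≡ n
  m+m≡n+n⇒m≡n {m} {n} eq = ℕP.*-cancelʳ-≡ m n 2 (trans (sym (m+m≡m*2 m)) (trans eq (m+m≡m*2 n)))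

f≡3[mod4]⇒a≢b∧b≢1+a : ∀ {a b f} → f % 4 ≡ 3 → a ℕ.+ b ≡ f ℕ.∸ 1 →
  (∃ λ x → a ≡ x ℕ.+ x) → (∃ λ y → b ≡ y ℕ.+ y) → a ≢ b × b ≢ suc a
f≡3[mod4]⇒a≢b∧b≢1+a {a} {b} {f} f%4≡3 a+b≡f∸1 (x , a≡2x) (y , b≡2y) = a≢b , b≢1+a
  where
  t : ℕ
  t = f / 4
  a≢b : a ≢ b
  a≢b a≡b = ℕP.0≢1+n (trans (sym (m*n%n≡0 x 4)) (trans (cong (_% 4) 4x≡2+4t) ([m+kn]%n≡m%n 2 t 4)))
    where
    4x≡2+4t : x ℕ.* 4 ≡ 2 ℕ.+ t ℕ.* 4
    4x≡2+4t = begin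
      x ℕ.* 4                        ≡⟨ ℕP.*-distribˡ-+ x 2 2 ⟩
      x ℕ.* 2 ℕ.+ x ℕ.* 2            ≡⟨ cong₂ ℕ._+_ (m+m≡m*2 x) (m+m≡m*2 x) ⟨
      (x ℕ.+ x) ℕ.+ (x ℕ.+ x)        ≡⟨ cong₂ ℕ._+_ a≡2x (trans (sym a≡b) a≡2x) ⟨
      a ℕ.+ b                        ≡⟨ trans a+b≡f∸1 (m∸1≡r+[m/d]*d {f} {4} f%4≡3) ⟩
      2 ℕ.+ t ℕ.* 4                  ∎
      where open ≡-Reasoning
  b≢1+a : b ≢ suc a
  b≢1+a b≡1+a = m+m≢1+n+n y x (trans (sym b≡2y) (trans b≡1+a (cong suc a≡2x)))

f≡2[mod4]⇒a≢b∧b≢1+a : ∀ {a b f} → f % 4 ≡ 2 → a ℕ.+ b ≡ f ℕ.∸ 1 →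
  (∃ λ x → a ≡ suc (x ℕ.+ x)) → a ≢ b × b ≢ suc a
f≡2[mod4]⇒a≢b∧b≢1+a {a} {b} {f} f%4≡2 a+b≡f∸1 (x , a≡1+2x) = a≢b , b≢1+a
  where
  t : ℕ
  t = f / 4
  a+b≡1+2t+2t : a ℕ.+ b ≡ suc (t ℕ.* 2 ℕ.+ t ℕ.* 2)
  a+b≡1+2t+2t = trans a+b≡f∸1 (trans (m∸1≡r+[m/d]*d {f} {4} f%4≡2) (cong suc (ℕP.*-distribˡ-+ t 2 2)))
  a≢b : a ≢ b
  a≢b a≡b = m+m≢1+n+n a (t ℕ.* 2) (trans (cong (a ℕ.+_) a≡b) a+b≡1+2t+2t)
  b≢1+a : b ≢ suc a
  b≢1+a b≡1+a = m+m≢1+n+n t x (trans (m+m≡m*2 t) (trans (sym a≡2t) a≡1+2x))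
    where
    a≡2t : a ≡ t ℕ.* 2
    a≡2t = m+m≡n+n⇒m≡n (ℕP.suc-injective (trans (sym (ℕP.+-suc a a)) (trans (cong (a ℕ.+_) (sym b≡1+a)) a+b≡1+2t+2t)))

+a≡+[a+b]-+b : ∀ a b → ℤ.+ a ≡ ℤ.+ (a ℕ.+ b) ℤ.- ℤ.+ b
+a≡+[a+b]-+b a b = lemma (ℤ.+ a) (ℤ.+ b)
  where
  lemma : ∀ (x y : ℤ) → x ≡ x ℤ.+ y ℤ.- y
  lemma = solve-∀

+a-+b≡+[1+a]-+c⇒c≡1+b : ∀ {a b c} → ℤ.+ a ℤ.- ℤ.+ b ≡ ℤ.+ suc a ℤ.- ℤ.+ c → c ≡ suc b
+a-+b≡+[1+a]-+c⇒c≡1+b {a} {b} {c} eq = ℕP.+-cancelˡ-≡ a c (suc b) (trans (ℤP.+-injective (begin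
  ℤ.+ a ℤ.+ ℤ.+ c                                ≡⟨ shift (ℤ.+ a) (ℤ.+ b) (ℤ.+ c) ⟩
  (ℤ.+ a ℤ.- ℤ.+ b) ℤ.+ (ℤ.+ b ℤ.+ ℤ.+ c)        ≡⟨ cong (ℤ._+ (ℤ.+ b ℤ.+ ℤ.+ c)) eq ⟩
  (ℤ.+ suc a ℤ.- ℤ.+ c) ℤ.+ (ℤ.+ b ℤ.+ ℤ.+ c)    ≡⟨ unshift (ℤ.+ suc a) (ℤ.+ b) (ℤ.+ c) ⟩
  ℤ.+ suc a ℤ.+ ℤ.+ b                            ∎)) (sym (ℕP.+-suc a b)))
  where
  open ≡-Reasoning
  shift : ∀ (x y z : ℤ) → x ℤ.+ z ≡ (x ℤ.- y) ℤ.+ (y ℤ.+ z)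
  shift = solve-∀
  unshift : ∀ (x y z : ℤ) → (x ℤ.- z) ℤ.+ (y ℤ.+ z) ≡ x ℤ.+ y
  unshift = solve-∀

module _ {A : Set} where

  unique-length-≡ : {xs ys : List A} → Unique xs → Unique ys →
                    (∀ {x} → x ∈ xs ⇔ x ∈ ys) → length xs ≡ length ys
  unique-length-≡ u v same = ↭-length (∼bag⇒↭ (unique∧set⇒bag u v same))

  unique-map⁺ : ∀ {B : Set} {f : A → B} {xs} →
                (∀ {a b} → a ∈ xs → b ∈ xs → f a ≡ f b → a ≡ b) → Unique xs → Unique (map f xs)
  unique-map⁺ {xs = []}     inj []       = []
  unique-map⁺ {xs = x ∷ xs} inj (x∉ ∷ u) =
    All.tabulate (λ fy∈ fx≡fy → let y , y∈ , fy≡ = ∈-map⁻ _ fy∈ in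
                   All.lookup x∉ y∈ (inj (here refl) (there y∈) (trans fx≡fy fy≡)))
    ∷ unique-map⁺ (λ a∈ b∈ → inj (there a∈) (there b∈)) u

  module _ (_≟_ : DecidableEquality A) where

    remove : A → List A → List A
    remove x = filter (¬? ∘ (x ≟_))

    ∈-remove⁺ : ∀ {x y ys} → y ∈ ys → x ≢ y → y ∈ remove x ys
    ∈-remove⁺ = ∈-filter⁺ (¬? ∘ (_ ≟_))

    ∈-remove⁻ : ∀ {x y} ys → y ∈ remove x ys → y ∈ ys × x ≢ y
    ∈-remove⁻ ys = ∈-filter⁻ (¬? ∘ (_ ≟_)) {xs = ys}

    unique-remove : ∀ {x ys} → Unique ys → Unique (remove x ys)
    unique-remove = Unique.filter⁺ (¬? ∘ (_ ≟_))

    length-remove : ∀ {x ys} → Unique ys → x ∈ ys → suc (length (remove x ys)) ≡ length ys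
    length-remove {x} {ys} u x∈ = unique-length-≡
      (All.tabulate (proj₂ ∘ ∈-remove⁻ ys) ∷ unique-remove u) u (mk⇔ to from)
      where
      to : ∀ {y} → y ∈ x ∷ remove x ys → y ∈ ys
      to (here refl) = x∈
      to (there y∈)  = proj₁ (∈-remove⁻ ys y∈)
      from : ∀ {y} → y ∈ ys → y ∈ x ∷ remove x ys
      from {y} y∈ with x ≟ y
      ... | yes refl = here refl
      ... | no x≢y   = there (∈-remove⁺ y∈ x≢y)

    unique-length-≤ : ∀ {xs ys} → Unique xs → (∀ {x} → x ∈ xs → x ∈ ys) → length xs ≤ length ys
    unique-length-≤ {xs} {ys} u xs⊆ys = begin
      length xs                                        ≡⟨ unique-length-≡ u unique-sub (mk⇔ to from) ⟩
      length (filter (_∈? xs) (deduplicate _≟_ ys))    ≤⟨ length-filter (_∈? xs) (deduplicate _≟_ ys) ⟩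
      length (deduplicate _≟_ ys)                      ≤⟨ length-deduplicate _≟_ ys ⟩
      length ys                                        ∎
      where
      open ℕP.≤-Reasoning
      open import Data.List.Membership.DecPropositional _≟_ using (_∈?_)
      open import Data.List.Relation.Unary.Unique.DecPropositional.Properties _≟_ using (deduplicate-!)
      unique-sub : Unique (filter (_∈? xs) (deduplicate _≟_ ys))
      unique-sub = Unique.filter⁺ (_∈? xs) (deduplicate-! ys)
      to : ∀ {x} → x ∈ xs → x ∈ filter (_∈? xs) (deduplicate _≟_ ys)
      to x∈ = ∈-filter⁺ (_∈? xs) (∈-deduplicate⁺ _≟_ (xs⊆ys x∈)) x∈
      from : ∀ {x} → x ∈ filter (_∈? xs) (deduplicate _≟_ ys) → x ∈ xs
      from = proj₂ ∘ ∈-filter⁻ (_∈? xs) {xs = deduplicate _≟_ ys}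

module _ {A B : Set} (f : A → List B) where

  ∈-concatMap⁻′ : ∀ {xs y} → y ∈ concatMap f xs → ∃ λ x → x ∈ xs × y ∈ f x
  ∈-concatMap⁻′ {xs} = find ∘ ∈-concatMap⁻ f {xs = xs}

  ∈-concatMap⁺′ : ∀ {xs x y} → x ∈ xs → y ∈ f x → y ∈ concatMap f xs
  ∈-concatMap⁺′ {xs} x∈ y∈ = ∈-concatMap⁺ f {xs = xs} (lose x∈ y∈)

  unique-concatMap⁺ : ∀ {xs} → Unique xs → (∀ {a} → a ∈ xs → Unique (f a)) →
    (∀ {a b} → a ∈ xs → b ∈ xs → a ≢ b → ∀ {z} → z ∈ f a → z ∉ f b) → Unique (concatMap f xs)
  unique-concatMap⁺ {[]}     _          _        _        = []
  unique-concatMap⁺ {x ∷ xs} (x∉ ∷ u) unique-f disjoint-f =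
    Unique.++⁺ (unique-f (here refl))
      (unique-concatMap⁺ u (unique-f ∘ there) (λ a∈ b∈ → disjoint-f (there a∈) (there b∈)))
      λ (z∈fx , z∈rest) → let y , y∈ , z∈fy = ∈-concatMap⁻′ {xs} z∈rest
                           in disjoint-f (here refl) (there y∈) (All.lookup x∉ y∈) z∈fx z∈fy

count-map : ∀ {A B : Set} (_≟_ : DecidableEquality B) (b : B) (f : A → B) (xs : List A) →
            length (filter (b ≟_) (map f xs)) ≡ length (filter ((b ≟_) ∘ f) xs)
count-map _≟_ b f []       = refl
count-map _≟_ b f (x ∷ xs) with b ≟ f x
... | yes _ = cong suc (count-map _≟_ b f xs)
... | no  _ = count-map _≟_ b f xs

length-bijection : ∀ {A B : Set} {xs : List A} {ys : List B} → Unique xs → Unique ys →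
  (f : A → B) (g : B → A) → (∀ {a} → a ∈ xs → f a ∈ ys) → (∀ {b} → b ∈ ys → g b ∈ xs) →
  (∀ {a} → a ∈ xs → g (f a) ≡ a) → (∀ {b} → b ∈ ys → f (g b) ≡ b) → length xs ≡ length ys
length-bijection {xs = xs} {ys} u v f g f∈ g∈ gf fg = begin
  length xs          ≡⟨ length-map f xs ⟨
  length (map f xs)  ≡⟨ unique-length-≡ (unique-map⁺ f-inj u) v (mk⇔ to from) ⟩
  length ys          ∎
  where
  open ≡-Reasoning
  f-inj : ∀ {a b} → a ∈ xs → b ∈ xs → f a ≡ f b → a ≡ b
  f-inj a∈ b∈ fa≡fb = trans (sym (gf a∈)) (trans (cong g fa≡fb) (gf b∈))
  to : ∀ {b} → b ∈ map f xs → b ∈ ys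
  to b∈ = let a , a∈ , b≡ = ∈-map⁻ f b∈ in subst (_∈ ys) (sym b≡) (f∈ a∈)
  from : ∀ {b} → b ∈ ys → b ∈ map f xs
  from b∈ = subst (_∈ map f xs) (fg b∈) (∈-map⁺ f (g∈ b∈))

module _ {A : Set} (_≟_ : DecidableEquality A) (ι : A → A) where

  even-length-involution : ∀ {L} → Unique L → (∀ {x} → x ∈ L → ι x ∈ L) →
    (∀ {x} → x ∈ L → ι (ι x) ≡ x) → (∀ {x} → x ∈ L → ι x ≢ x) → ∃ λ k → length L ≡ k ℕ.+ k
  even-length-involution {L} = go L (<-wellFounded (length L))
    where
    go : ∀ L → Acc _<_ (length L) → Unique L → (∀ {x} → x ∈ L → ι x ∈ L) →
         (∀ {x} → x ∈ L → ι (ι x) ≡ x) → (∀ {x} → x ∈ L → ι x ≢ x) → ∃ λ k → length L ≡ k ℕ.+ k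
    go [] _ _ _ _ _ = 0 , refl
    go (x ∷ L) (acc rs) (x∉L ∷ u) closed invol free = suc k , len
      where
      ιx∈L : ι x ∈ L
      ιx∈L with closed (here refl)
      ... | here ιx≡x = ⊥-elim (free (here refl) ιx≡x)
      ... | there ιx∈ = ιx∈
      L′ : List A
      L′ = remove _≟_ (ι x) L
      len-L′ : suc (length L′) ≡ length L
      len-L′ = length-remove _≟_ u ιx∈L
      closed′ : ∀ {y} → y ∈ L′ → ι y ∈ L′
      closed′ y∈′ with ∈-remove⁻ _≟_ L y∈′
      ... | y∈ , ιx≢y with closed (there y∈)
      ...   | here ιy≡x = ⊥-elim (ιx≢y (trans (cong ι (sym ιy≡x)) (invol (there y∈))))
      ...   | there ιy∈ = ∈-remove⁺ _≟_ ιy∈ λ ιx≡ιy →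
                All.lookup x∉L y∈ (trans (sym (invol (here refl))) (trans (cong ι ιx≡ιy) (invol (there y∈))))
      IH : ∃ λ k → length L′ ≡ k ℕ.+ k
      IH = go L′ (rs (ℕP.m<n⇒m<1+n (subst (length L′ <_) len-L′ (ℕP.n<1+n _))))
              (unique-remove _≟_ u) closed′
              (λ y∈′ → invol (there (proj₁ (∈-remove⁻ _≟_ L y∈′))))
              (λ y∈′ → free (there (proj₁ (∈-remove⁻ _≟_ L y∈′))))
      k : ℕ
      k = proj₁ IH
      len : suc (length L) ≡ suc k ℕ.+ suc k
      len = cong suc (trans (sym len-L′) (trans (cong suc (proj₂ IH)) (sym (ℕP.+-suc k k))))

list-pigeonhole : ∀ {A : Set} {k} {ys : List A} (h : Fin k → A) → (∀ i → h i ∈ ys) →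
                  length ys < k → ∃₂ λ i j → i Fin.< j × h i ≡ h j
list-pigeonhole {ys = ys} h h∈ len< =
  let i , j , i<j , same = FinP.pigeonhole len< (index ∘ h∈)
  in i , j , i<j , trans (lookup-index (h∈ i)) (trans (cong (lookup ys) same) (sym (lookup-index (h∈ j))))

module FieldProperties (K : FiniteField) where

  open FiniteField K public
  open IsCommutativeRing isCommutativeRing public
    using (+-assoc; +-comm; +-identityˡ; +-identityʳ; -‿inverseˡ; -‿inverseʳ;
           *-assoc; *-comm; *-identityˡ; *-identityʳ; distribˡ; distribʳ; zeroˡ; zeroʳ)

  private
    ring : CommutativeRing _ _
    ring = record { isCommutativeRing = isCommutativeRing }

  open RingProperties (CommutativeRing.ring ring) public using (-1*x≈-x; -‿distribˡ-*)
  open AbelianGroupProperties (CommutativeRing.+-abelianGroup ring) public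
    using () renaming (x∙y⁻¹≈ε⇒x≈y to x-y≡0⇒x≡y; inverseˡ-unique to x+y≡0⇒x≡-y;
                       ⁻¹-involutive to -‿involutive; ⁻¹-∙-comm to -x+-y≡-[x+y]; ⁻¹-anti-homo‿- to -‿anti-homo--)
  open import Tactic.RingSolver.NonReflective (fromCommutativeRing ring (λ _ → nothing)) public
    using (solve; _⊜_; _⊕_; _⊗_; ⊝_)
  open ≡-Reasoning

  1≢0 : 1# ≢ 0#
  1≢0 = 0≢1 ∘ sym

  x-y+y≡x : ∀ x y → x - y + y ≡ x
  x-y+y≡x x y = trans (+-assoc x (- y) y) (trans (cong (x +_) (-‿inverseˡ y)) (+-identityʳ x))

  x+y-y≡x : ∀ x y → x + y - y ≡ x
  x+y-y≡x x y = trans (+-assoc x y (- y)) (trans (cong (x +_) (-‿inverseʳ y)) (+-identityʳ x))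

  -- The junk value 0 ⁻¹ = 0 is never used: every lemma below asks for a nonzero argument.
  _⁻¹ : F → F
  x ⁻¹ with x ≟ 0#
  ... | yes _  = 0#
  ... | no x≢0 = proj₁ (inverse x x≢0)

  x*x⁻¹≡1 : ∀ {x} → x ≢ 0# → x * x ⁻¹ ≡ 1#
  x*x⁻¹≡1 {x} x≢0 with x ≟ 0#
  ... | yes x≡0 = ⊥-elim (x≢0 x≡0)
  ... | no x≢0  = proj₂ (inverse x x≢0)

  x⁻¹*x≡1 : ∀ {x} → x ≢ 0# → x ⁻¹ * x ≡ 1#
  x⁻¹*x≡1 x≢0 = trans (*-comm _ _) (x*x⁻¹≡1 x≢0)

  *-cancelˡ : ∀ {x a b} → x ≢ 0# → x * a ≡ x * b → a ≡ b
  *-cancelˡ {x} {a} {b} x≢0 xa≡xb = begin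
    a                ≡⟨ *-identityˡ a ⟨
    1# * a           ≡⟨ cong (_* a) (x⁻¹*x≡1 x≢0) ⟨
    x ⁻¹ * x * a     ≡⟨ *-assoc _ _ _ ⟩
    x ⁻¹ * (x * a)   ≡⟨ cong (x ⁻¹ *_) xa≡xb ⟩
    x ⁻¹ * (x * b)   ≡⟨ *-assoc _ _ _ ⟨
    x ⁻¹ * x * b     ≡⟨ cong (_* b) (x⁻¹*x≡1 x≢0) ⟩
    1# * b           ≡⟨ *-identityˡ b ⟩
    b                ∎

  *-nonzero : ∀ {x y} → x ≢ 0# → y ≢ 0# → x * y ≢ 0#
  *-nonzero x≢0 y≢0 xy≡0 = y≢0 (*-cancelˡ x≢0 (trans xy≡0 (sym (zeroʳ _))))

  ⁻¹-unique : ∀ {x y} → x * y ≡ 1# → x ⁻¹ ≡ y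
  ⁻¹-unique {x} {y} xy≡1 = *-cancelˡ x≢0 (trans (x*x⁻¹≡1 x≢0) (sym xy≡1))
    where
    x≢0 : x ≢ 0#
    x≢0 x≡0 = 0≢1 (trans (sym (zeroˡ y)) (trans (cong (_* y) (sym x≡0)) xy≡1))

  ⁻¹-nonzero : ∀ {x} → x ≢ 0# → x ⁻¹ ≢ 0#
  ⁻¹-nonzero {x} x≢0 x⁻¹≡0 = 0≢1 (trans (sym (zeroʳ x)) (trans (cong (x *_) (sym x⁻¹≡0)) (x*x⁻¹≡1 x≢0)))

  ⁻¹-involutive : ∀ {x} → x ≢ 0# → x ⁻¹ ⁻¹ ≡ x
  ⁻¹-involutive x≢0 = ⁻¹-unique (x⁻¹*x≡1 x≢0)

  ⁻¹-distrib-* : ∀ {x y} → x ≢ 0# → y ≢ 0# → (x * y) ⁻¹ ≡ x ⁻¹ * y ⁻¹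
  ⁻¹-distrib-* {x} {y} x≢0 y≢0 = ⁻¹-unique (begin
    x * y * (x ⁻¹ * y ⁻¹)      ≡⟨ solve 4 (λ x y a b → ((x ⊗ y) ⊗ (a ⊗ b)) ⊜ ((x ⊗ a) ⊗ (y ⊗ b))) refl x y (x ⁻¹) (y ⁻¹) ⟩
    x * x ⁻¹ * (y * y ⁻¹)      ≡⟨ cong₂ _*_ (x*x⁻¹≡1 x≢0) (x*x⁻¹≡1 y≢0) ⟩
    1# * 1#                    ≡⟨ *-identityˡ 1# ⟩
    1#                         ∎)

  x*y⁻¹*y≡x : ∀ {x y} → y ≢ 0# → x * y ⁻¹ * y ≡ x
  x*y⁻¹*y≡x {x} y≢0 = trans (*-assoc _ _ _) (trans (cong (x *_) (x⁻¹*x≡1 y≢0)) (*-identityʳ x))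

  x*y*y⁻¹≡x : ∀ {x y} → y ≢ 0# → x * y * y ⁻¹ ≡ x
  x*y*y⁻¹≡x {x} y≢0 = trans (*-assoc _ _ _) (trans (cong (x *_) (x*x⁻¹≡1 y≢0)) (*-identityʳ x))

  [x-1]*y≡x*y-y : ∀ x y → (x - 1#) * y ≡ x * y - y
  [x-1]*y≡x*y-y x y = begin
    (x - 1#) * y          ≡⟨ distribʳ y x (- 1#) ⟩
    x * y + - 1# * y      ≡⟨ cong (x * y +_) (-1*x≈-x y) ⟩
    x * y - y             ∎

  x*y⁻¹-1≡[x-y]*y⁻¹ : ∀ {x y} → y ≢ 0# → x * y ⁻¹ - 1# ≡ (x - y) * y ⁻¹
  x*y⁻¹-1≡[x-y]*y⁻¹ {x} {y} y≢0 = begin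
    x * y ⁻¹ - 1#                ≡⟨ cong (x * y ⁻¹ +_) (cong -_ (x*x⁻¹≡1 y≢0)) ⟨
    x * y ⁻¹ - y * y ⁻¹          ≡⟨ cong (x * y ⁻¹ +_) (-‿distribˡ-* y (y ⁻¹)) ⟩
    x * y ⁻¹ + - y * y ⁻¹        ≡⟨ distribʳ (y ⁻¹) x (- y) ⟨
    (x - y) * y ⁻¹               ∎

  ^-homo-+ : ∀ x a b → x ^ (a ℕ.+ b) ≡ x ^ a * x ^ b
  ^-homo-+ x zero    b = sym (*-identityˡ _)
  ^-homo-+ x (suc a) b = trans (cong (x *_) (^-homo-+ x a b)) (sym (*-assoc _ _ _))

  1^n≡1 : ∀ a → 1# ^ a ≡ 1#
  1^n≡1 zero    = refl
  1^n≡1 (suc a) = trans (*-identityˡ _) (1^n≡1 a)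

  ^-distrib-* : ∀ x y a → (x * y) ^ a ≡ x ^ a * y ^ a
  ^-distrib-* x y zero    = sym (*-identityˡ 1#)
  ^-distrib-* x y (suc a) = trans (cong (x * y *_) (^-distrib-* x y a))
    (solve 4 (λ x y a b → ((x ⊗ y) ⊗ (a ⊗ b)) ⊜ ((x ⊗ a) ⊗ (y ⊗ b))) refl x y (x ^ a) (y ^ a))

  ^-*-assoc : ∀ x a b → x ^ (a ℕ.* b) ≡ (x ^ a) ^ b
  ^-*-assoc x zero    b = sym (1^n≡1 b)
  ^-*-assoc x (suc a) b = begin
    x ^ (b ℕ.+ a ℕ.* b)     ≡⟨ ^-homo-+ x b (a ℕ.* b) ⟩
    x ^ b * x ^ (a ℕ.* b)   ≡⟨ cong (x ^ b *_) (^-*-assoc x a b) ⟩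
    x ^ b * (x ^ a) ^ b     ≡⟨ ^-distrib-* x (x ^ a) b ⟨
    (x * x ^ a) ^ b         ∎

  ^-nonzero : ∀ {x} a → x ≢ 0# → x ^ a ≢ 0#
  ^-nonzero zero    x≢0 = 1≢0
  ^-nonzero (suc a) x≢0 = *-nonzero x≢0 (^-nonzero a x≢0)

  x²≡1⇒x≡±1 : ∀ {x} → x * x ≡ 1# → x ≡ 1# ⊎ x ≡ - 1#
  x²≡1⇒x≡±1 {x} x²≡1 with (x - 1#) ≟ 0#
  ... | yes x-1≡0 = inj₁ (x-y≡0⇒x≡y x 1# x-1≡0)
  ... | no x-1≢0  = inj₂ (x+y≡0⇒x≡-y x 1# (*-cancelˡ x-1≢0 (begin
    (x - 1#) * (x + 1#)                ≡⟨ distribʳ (x + 1#) x (- 1#) ⟩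
    x * (x + 1#) + - 1# * (x + 1#)     ≡⟨ cong₂ _+_ (distribˡ x x 1#) (-1*x≈-x (x + 1#)) ⟩
    (x * x + x * 1#) - (x + 1#)        ≡⟨ cong₂ (λ a b → (a + b) - (x + 1#)) x²≡1 (*-identityʳ x) ⟩
    (1# + x) - (x + 1#)                ≡⟨ cong (λ a → a - (x + 1#)) (+-comm 1# x) ⟩
    (x + 1#) - (x + 1#)                ≡⟨ -‿inverseʳ (x + 1#) ⟩
    0#                                 ≡⟨ zeroʳ _ ⟨
    (x - 1#) * 0#          ∎)))

module Cyclotomy (K : FiniteField) (α : FiniteField.F K) (α-primitive : FiniteField.IsPrimitive K α) where

  open FieldProperties K public
  open ≡-Reasoning

  n : ℕ
  n = order ℕ.∸ 1

  n>0 : 0 < n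
  n>0 = ℕP.≤-trans (s≤s z≤n) (ℕP.∸-monoˡ-≤ 1 two≤order)
    where
    two≤order : 2 ≤ order
    two≤order = unique-length-≤ _≟_ {xs = 0# ∷ 1# ∷ []} ((0≢1 All.∷ All.[]) ∷ All.[] ∷ [])
                  (λ {x} _ → elems-complete x)

  instance
    n-nonZero : NonZero n
    n-nonZero = ℕ.>-nonZero n>0

  α^≢0 : ∀ a → α ^ a ≢ 0#
  α^≢0 a = ^-nonzero a (proj₁ α-primitive)

  nonzeros : List F
  nonzeros = remove _≟_ 0# elems

  ∈-nonzeros : ∀ {x} → x ≢ 0# → x ∈ nonzeros
  ∈-nonzeros {x} x≢0 = ∈-remove⁺ _≟_ (elems-complete x) (x≢0 ∘ sym)

  length-nonzeros : length nonzeros ≡ n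
  length-nonzeros = cong ℕ.pred (length-remove _≟_ elems-unique (elems-complete 0#))

  α^a≡α^[a%d] : ∀ d .{{_ : NonZero d}} → α ^ d ≡ 1# → ∀ a → α ^ a ≡ α ^ (a % d)
  α^a≡α^[a%d] d α^d≡1 a = begin
    α ^ a                               ≡⟨ cong (α ^_) (trans (m≡m%n+[m/n]*n a d) (cong (a % d ℕ.+_) (ℕP.*-comm (a / d) d))) ⟩
    α ^ (a % d ℕ.+ d ℕ.* (a / d))       ≡⟨ ^-homo-+ α (a % d) _ ⟩
    α ^ (a % d) * α ^ (d ℕ.* (a / d))   ≡⟨ cong (α ^ (a % d) *_) (^-*-assoc α d (a / d)) ⟩
    α ^ (a % d) * (α ^ d) ^ (a / d)     ≡⟨ cong (λ x → α ^ (a % d) * x ^ (a / d)) α^d≡1 ⟩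
    α ^ (a % d) * 1# ^ (a / d)          ≡⟨ cong (α ^ (a % d) *_) (1^n≡1 (a / d)) ⟩
    α ^ (a % d) * 1#                    ≡⟨ *-identityʳ _ ⟩
    α ^ (a % d)                         ∎

  -- Every nonzero element is among α^0, …, α^(d-1).
  α^d≡1⇒n≤d : ∀ {d} → 0 < d → α ^ d ≡ 1# → n ≤ d
  α^d≡1⇒n≤d {d} d>0 α^d≡1 =
    subst₂ _≤_ length-nonzeros (trans (length-map (α ^_) (upTo d)) (length-upTo d))
      (unique-length-≤ _≟_ (unique-remove _≟_ elems-unique) power)
    where
    instance
      d-nonZero : NonZero d
      d-nonZero = ℕ.>-nonZero d>0
    power : ∀ {x} → x ∈ nonzeros → x ∈ map (α ^_) (upTo d)
    power {x} x∈ with proj₂ α-primitive x (proj₂ (∈-remove⁻ _≟_ elems x∈) ∘ sym)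
    ... | a , α^a≡x = subst (_∈ map (α ^_) (upTo d)) (trans (sym (α^a≡α^[a%d] d α^d≡1 a)) α^a≡x)
                            (∈-map⁺ (α ^_) (∈-upTo⁺ (m%n<n a d)))

  α^i≡α^j⇒α^[j∸i]≡1 : ∀ {i j} → i ≤ j → α ^ i ≡ α ^ j → α ^ (j ℕ.∸ i) ≡ 1#
  α^i≡α^j⇒α^[j∸i]≡1 {i} {j} i≤j α^i≡α^j = sym (*-cancelˡ (α^≢0 i) (begin
    α ^ i * 1#               ≡⟨ *-identityʳ _ ⟩
    α ^ i                    ≡⟨ α^i≡α^j ⟩
    α ^ j                    ≡⟨ cong (α ^_) (ℕP.m+[n∸m]≡n i≤j) ⟨
    α ^ (i ℕ.+ (j ℕ.∸ i))    ≡⟨ ^-homo-+ α i _ ⟩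
    α ^ i * α ^ (j ℕ.∸ i)    ∎))

  -- Pigeonhole on α^0, …, α^n inside the n nonzero elements gives a period d ≤ n.
  α^n≡1 : α ^ n ≡ 1#
  α^n≡1 with list-pigeonhole (λ (i : Fin (suc n)) → α ^ toℕ i) (λ i → ∈-nonzeros (α^≢0 (toℕ i)))
                             (subst (_< suc n) (sym length-nonzeros) (ℕP.n<1+n n))
  ... | i , j , i<j , α^i≡α^j = subst (λ d → α ^ d ≡ 1#) d≡n α^d≡1
    where
    α^d≡1 : α ^ (toℕ j ℕ.∸ toℕ i) ≡ 1#
    α^d≡1 = α^i≡α^j⇒α^[j∸i]≡1 (ℕP.<⇒≤ i<j) α^i≡α^j
    d≡n : toℕ j ℕ.∸ toℕ i ≡ n
    d≡n = ℕP.≤-antisym (ℕP.≤-trans (ℕP.m∸n≤m (toℕ j) (toℕ i)) (ℕP.≤-pred (FinP.toℕ<n j)))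
                       (α^d≡1⇒n≤d (ℕP.m<n⇒0<n∸m i<j) α^d≡1)

  α^-injective : ∀ {i j} → i < n → j < n → α ^ i ≡ α ^ j → i ≡ j
  α^-injective {i} {j} i<n j<n α^i≡α^j with ℕP.<-cmp i j
  ... | tri≈ _ i≡j _ = i≡j
  ... | tri< i<j _ _ = ⊥-elim (ℕP.<⇒≱ (ℕP.≤-<-trans (ℕP.m∸n≤m j i) j<n)
                         (α^d≡1⇒n≤d (ℕP.m<n⇒0<n∸m i<j) (α^i≡α^j⇒α^[j∸i]≡1 (ℕP.<⇒≤ i<j) α^i≡α^j)))
  ... | tri> _ _ j<i = ⊥-elim (ℕP.<⇒≱ (ℕP.≤-<-trans (ℕP.m∸n≤m i j) i<n)
                         (α^d≡1⇒n≤d (ℕP.m<n⇒0<n∸m j<i) (α^i≡α^j⇒α^[j∸i]≡1 (ℕP.<⇒≤ j<i) (sym α^i≡α^j))))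

  α^a≡α^b⇒a≡b[mod-d] : ∀ {a b} d .{{_ : NonZero d}} → d ∣ n → α ^ a ≡ α ^ b → a % d ≡ b % d
  α^a≡α^b⇒a≡b[mod-d] {a} {b} d d∣n α^a≡α^b = begin
    a % d        ≡⟨ m∣n⇒o%n%m≡o%m d n a d∣n ⟨
    a % n % d    ≡⟨ cong (_% d) a%n≡b%n ⟩
    b % n % d    ≡⟨ m∣n⇒o%n%m≡o%m d n b d∣n ⟩
    b % d        ∎
    where
    a%n≡b%n : a % n ≡ b % n
    a%n≡b%n = α^-injective (m%n<n a n) (m%n<n b n)
                (trans (sym (α^a≡α^[a%d] n α^n≡1 a)) (trans α^a≡α^b (α^a≡α^[a%d] n α^n≡1 b)))

  [α^a]⁻¹≡α^[a*[n∸1]] : ∀ a → (α ^ a) ⁻¹ ≡ α ^ (a ℕ.* (n ℕ.∸ 1))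
  [α^a]⁻¹≡α^[a*[n∸1]] a = ⁻¹-unique (begin
    α ^ a * α ^ (a ℕ.* (n ℕ.∸ 1))   ≡⟨ ^-homo-+ α a _ ⟨
    α ^ (a ℕ.+ a ℕ.* (n ℕ.∸ 1))     ≡⟨ cong (α ^_) (trans (sym (ℕP.*-suc a (n ℕ.∸ 1))) (cong (a ℕ.*_) (ℕP.suc-pred n))) ⟩
    α ^ (a ℕ.* n)                   ≡⟨ cong (α ^_) (ℕP.*-comm a n) ⟩
    α ^ (n ℕ.* a)                   ≡⟨ ^-*-assoc α n a ⟩
    (α ^ n) ^ a                     ≡⟨ cong (_^ a) α^n≡1 ⟩
    1# ^ a                          ≡⟨ 1^n≡1 a ⟩
    1#                              ∎)

  InClass : (d : ℕ) .{{_ : NonZero d}} → ℕ → F → Set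
  InClass d i z = ∃ λ a → z ≡ α ^ a × a % d ≡ i

  private
    [i+dk]%d≡i : ∀ {d} .{{_ : NonZero d}} i k → i < d → (i ℕ.+ d ℕ.* k) % d ≡ i
    [i+dk]%d≡i {d} i k i<d =
      trans (cong (λ w → (i ℕ.+ w) % d) (ℕP.*-comm d k)) (trans ([m+kn]%n≡m%n i k d) (m<n⇒m%n≡m i<d))

    i+dk<n : ∀ {d i k} → d ∣ n → i < d → d ℕ.* k < n → i ℕ.+ d ℕ.* k < n
    i+dk<n {d} {i} {k} (divides c n≡cd) i<d dk<n = ℕP.<-≤-trans (ℕP.+-monoˡ-< (d ℕ.* k) i<d)
      (subst (d ℕ.+ d ℕ.* k ≤_) (trans (ℕP.*-comm d c) (sym n≡cd))
        (subst (_≤ d ℕ.* c) (ℕP.*-suc d k) (ℕP.*-monoʳ-≤ d k<c)))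
      where
      k<c : k < c
      k<c = ℕP.*-cancelʳ-< _ k c (subst (_< c ℕ.* d) (ℕP.*-comm d k) (subst (d ℕ.* k <_) n≡cd dk<n))

  module _ (d : ℕ) .{{_ : NonZero d}} where

    private
      inRange? : Decidable (λ k → d ℕ.* k < n)
      inRange? k = d ℕ.* k ℕ.<? n

      range : List ℕ
      range = filter inRange? (upTo n)

      ∈-range⁻ : ∀ {k} → k ∈ range → d ℕ.* k < n
      ∈-range⁻ = proj₂ ∘ ∈-filter⁻ inRange? {xs = upTo n}

    ∈C⇒InClass : ∀ {i z} → i < d → z ∈ C α d i → InClass d i z
    ∈C⇒InClass {i} i<d z∈ with ∈-map⁻ (λ k → α ^ (i ℕ.+ d ℕ.* k)) z∈
    ... | k , _ , z≡ = i ℕ.+ d ℕ.* k , z≡ , [i+dk]%d≡i i k i<d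

    InClass⇒∈C : ∀ {i z} → d ∣ n → i < d → InClass d i z → z ∈ C α d i
    InClass⇒∈C {i} {z} d∣n i<d (a , z≡α^a , a%d≡i) =
      subst (_∈ C α d i) (sym (trans z≡α^a (trans (α^a≡α^[a%d] n α^n≡1 a) (cong (α ^_) r≡i+dk))))
        (∈-map⁺ (λ k → α ^ (i ℕ.+ d ℕ.* k)) (∈-filter⁺ inRange? (∈-upTo⁺ k<n) dk<n))
      where
      r k : ℕ
      r = a % n
      k = r / d
      r≡i+dk : r ≡ i ℕ.+ d ℕ.* k
      r≡i+dk = trans (m≡m%n+[m/n]*n r d)
                     (cong₂ ℕ._+_ (trans (m∣n⇒o%n%m≡o%m d n a d∣n) a%d≡i) (ℕP.*-comm k d))
      dk<n : d ℕ.* k < n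
      dk<n = ℕP.≤-<-trans (subst (d ℕ.* k ≤_) (sym r≡i+dk) (ℕP.m≤n+m (d ℕ.* k) i)) (m%n<n a n)
      k<n : k < n
      k<n = ℕP.≤-<-trans (ℕP.m≤n*m k d) dk<n

    unique-C : ∀ {i} → d ∣ n → i < d → Unique (C α d i)
    unique-C {i} d∣n i<d = unique-map⁺ exponent-injective (Unique.filter⁺ inRange? (Unique.upTo⁺ n))
      where
      exponent-injective : ∀ {k l} → k ∈ range → l ∈ range → α ^ (i ℕ.+ d ℕ.* k) ≡ α ^ (i ℕ.+ d ℕ.* l) → k ≡ l
      exponent-injective k∈ l∈ same = ℕP.*-cancelˡ-≡ _ _ d (ℕP.+-cancelˡ-≡ i _ _
        (α^-injective (i+dk<n d∣n i<d (∈-range⁻ k∈)) (i+dk<n d∣n i<d (∈-range⁻ l∈)) same))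

    length-C : ∀ {i m} → n ≡ d ℕ.* m → length (C α d i) ≡ m
    length-C {i} {m} n≡dm = begin
      length (C α d i)   ≡⟨ length-map (λ k → α ^ (i ℕ.+ d ℕ.* k)) range ⟩
      length range       ≡⟨ unique-length-≡ (Unique.filter⁺ inRange? (Unique.upTo⁺ n)) (Unique.upTo⁺ m) (mk⇔ to from) ⟩
      length (upTo m)    ≡⟨ length-upTo m ⟩
      m                  ∎
      where
      open ≡-Reasoning
      to : ∀ {k} → k ∈ range → k ∈ upTo m
      to {k} k∈ = ∈-upTo⁺ (ℕP.*-cancelˡ-< d k m (subst (d ℕ.* k <_) n≡dm (∈-range⁻ k∈)))
      from : ∀ {k} → k ∈ upTo m → k ∈ range
      from {k} k∈ = ∈-filter⁺ inRange? (∈-upTo⁺ (ℕP.≤-<-trans (ℕP.m≤n*m k d) dk<n)) dk<n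
        where
        dk<n : d ℕ.* k < n
        dk<n = subst (d ℕ.* k <_) (sym n≡dm) (ℕP.*-monoʳ-< d (∈-upTo⁻ k∈))

    InClass-nonzero : ∀ {i z} → InClass d i z → z ≢ 0#
    InClass-nonzero (a , z≡α^a , _) z≡0 = α^≢0 a (trans (sym z≡α^a) z≡0)

    InClass-total : ∀ {z} → z ≢ 0# → ∃ λ i → i < d × InClass d i z
    InClass-total z≢0 with proj₂ α-primitive _ z≢0
    ... | a , α^a≡z = a % d , m%n<n a d , a , sym α^a≡z , refl

    InClass-unique : ∀ {i j z} → d ∣ n → InClass d i z → InClass d j z → i ≡ j
    InClass-unique d∣n (a , z≡α^a , a%d≡i) (b , z≡α^b , b%d≡j) =
      trans (sym a%d≡i) (trans (α^a≡α^b⇒a≡b[mod-d] d d∣n (trans (sym z≡α^a) z≡α^b)) b%d≡j)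

    InClass-* : ∀ {i j k x y} → InClass d i x → InClass d j y → (i ℕ.+ j) % d ≡ k → InClass d k (x * y)
    InClass-* {i} {j} (a , x≡α^a , a%d≡i) (b , y≡α^b , b%d≡j) [i+j]%d≡k =
      a ℕ.+ b , trans (cong₂ _*_ x≡α^a y≡α^b) (sym (^-homo-+ α a b)) ,
      trans (%-distribˡ-+ a b d) (trans (cong₂ (λ u v → (u ℕ.+ v) % d) a%d≡i b%d≡j) [i+j]%d≡k)

    -- α^b⁻¹ = α^(b(n-1)), and b + b(n-1) = bn is a multiple of d.
    InClass-ratio : ∀ {i x y} → d ∣ n → InClass d i x → InClass d i y → InClass d 0 (x * y ⁻¹)
    InClass-ratio {i} d∣n@(divides c n≡cd) (a , x≡α^a , a%d≡i) (b , y≡α^b , b%d≡i) =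
      a ℕ.+ b ℕ.* (n ℕ.∸ 1) ,
      trans (cong₂ _*_ x≡α^a (trans (cong _⁻¹ y≡α^b) ([α^a]⁻¹≡α^[a*[n∸1]] b))) (sym (^-homo-+ α a _)) ,
      (begin
        (a ℕ.+ b ℕ.* (n ℕ.∸ 1)) % d                  ≡⟨ %-distribˡ-+ a _ d ⟩
        (a % d ℕ.+ (b ℕ.* (n ℕ.∸ 1)) % d) % d        ≡⟨ cong (λ w → (w ℕ.+ (b ℕ.* (n ℕ.∸ 1)) % d) % d) (trans a%d≡i (sym b%d≡i)) ⟩
        (b % d ℕ.+ (b ℕ.* (n ℕ.∸ 1)) % d) % d        ≡⟨ %-distribˡ-+ b _ d ⟨
        (b ℕ.+ b ℕ.* (n ℕ.∸ 1)) % d                  ≡⟨ cong (_% d) (trans (sym (ℕP.*-suc b (n ℕ.∸ 1))) (cong (b ℕ.*_) (ℕP.suc-pred n))) ⟩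
        (b ℕ.* n) % d                                ≡⟨ cong (λ w → (b ℕ.* w) % d) n≡cd ⟩
        (b ℕ.* (c ℕ.* d)) % d                        ≡⟨ cong (_% d) (ℕP.*-assoc b c d) ⟨
        (b ℕ.* c ℕ.* d) % d                          ≡⟨ m*n%n≡0 (b ℕ.* c) d ⟩
        0                                            ∎)
      where open ≡-Reasoning

  InClass-weaken : ∀ {d d′} .{{_ : NonZero d}} .{{_ : NonZero d′}} {i z} →
                   d′ ∣ d → InClass d i z → InClass d′ (i % d′) z
  InClass-weaken {d} {d′} d′∣d (a , z≡α^a , a%d≡i) =
    a , z≡α^a , trans (sym (m∣n⇒o%n%m≡o%m d′ d a d′∣d)) (cong (_% d′) a%d≡i)

  -- Inversion preserves the class modulo 2 because n - 1 is odd.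
  InClass₂-⁻¹ : ∀ {c z} → 2 ∣ n → InClass 2 c z → InClass 2 c (z ⁻¹)
  InClass₂-⁻¹ (divides zero n≡0) _ = ⊥-elim (ℕ.≢-nonZero⁻¹ n n≡0)
  InClass₂-⁻¹ {c} (divides (suc h) n≡2h+2) (a , z≡α^a , a%2≡c) =
    a ℕ.* (n ℕ.∸ 1) , trans (cong _⁻¹ z≡α^a) ([α^a]⁻¹≡α^[a*[n∸1]] a) , (begin
      (a ℕ.* (n ℕ.∸ 1)) % 2                ≡⟨ %-distribˡ-* a (n ℕ.∸ 1) 2 ⟩
      (a % 2 ℕ.* ((n ℕ.∸ 1) % 2)) % 2      ≡⟨ cong₂ (λ u v → (u ℕ.* v) % 2) a%2≡c [n∸1]%2≡1 ⟩
      (c ℕ.* 1) % 2                        ≡⟨ cong (_% 2) (ℕP.*-identityʳ c) ⟩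
      c % 2                                ≡⟨ cong (_% 2) a%2≡c ⟨
      a % 2 % 2                            ≡⟨ m%n%n≡m%n a 2 ⟩
      a % 2                                ≡⟨ a%2≡c ⟩
      c                                    ∎)
    where
    open ≡-Reasoning
    [n∸1]%2≡1 : (n ℕ.∸ 1) % 2 ≡ 1
    [n∸1]%2≡1 = trans (cong (λ w → (w ℕ.∸ 1) % 2) n≡2h+2) ([m+kn]%n≡m%n 1 h 2)

  module _ {m} (n≡m*2 : n ≡ m ℕ.* 2) where

    private
      m+m≡n : m ℕ.+ m ≡ n
      m+m≡n = trans (m+m≡m*2 m) (sym n≡m*2)

      α^m≢1 : α ^ m ≢ 1#
      α^m≢1 α^m≡1 = m≢0 (α^-injective m<n n>0 α^m≡1)
        where
        m≢0 : m ≢ 0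
        m≢0 m≡0 = ℕ.≢-nonZero⁻¹ n (trans (sym m+m≡n) (cong₂ ℕ._+_ m≡0 m≡0))
        m<n : m < n
        m<n = subst (m <_) m+m≡n (ℕP.m<m+n m (ℕP.n≢0⇒n>0 m≢0))

    α^m≡-1 : α ^ m ≡ - 1#
    α^m≡-1 = [ ⊥-elim ∘ α^m≢1 , id ]′
               (x²≡1⇒x≡±1 (trans (sym (^-homo-+ α m m)) (trans (cong (α ^_) m+m≡n) α^n≡1)))

    -1≢1 : - 1# ≢ 1#
    -1≢1 -1≡1 = α^m≢1 (trans α^m≡-1 -1≡1)

module Squares (K : FiniteField) (α : FiniteField.F K) (α-primitive : FiniteField.IsPrimitive K α)
               (k : ℕ) (n≡k*4 : FiniteField.order K ℕ.∸ 1 ≡ k ℕ.* 4) where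

  open Cyclotomy K α α-primitive public
  open ≡-Reasoning

  Square NonSquare : F → Set
  Square    = InClass 2 0
  NonSquare = InClass 2 1

  n≡2k*2 : n ≡ (k ℕ.* 2) ℕ.* 2
  n≡2k*2 = trans n≡k*4 (sym (ℕP.*-assoc k 2 2))

  2∣n : 2 ∣ n
  2∣n = divides (k ℕ.* 2) n≡2k*2

  0<2 : 0 < 2
  0<2 = s≤s z≤n

  1<2 : 1 < 2
  1<2 = s≤s (s≤s z≤n)

  square⊎nonSquare : ∀ {z} → z ≢ 0# → Square z ⊎ NonSquare z
  square⊎nonSquare z≢0 with InClass-total 2 z≢0
  ... | 0 , _ , z∈ = inj₁ z∈
  ... | 1 , _ , z∈ = inj₂ z∈
  ... | suc (suc _) , s≤s (s≤s ()) , _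

  ¬square∧nonSquare : ∀ {z} → Square z → NonSquare z → ⊥
  ¬square∧nonSquare sq nsq = ℕP.0≢1+n (InClass-unique 2 2∣n sq nsq)

  -1-square : Square (- 1#)
  -1-square = k ℕ.* 2 , sym (α^m≡-1 {k ℕ.* 2} n≡2k*2) , m*n%n≡0 k 2

  2≢0 : 1# + 1# ≢ 0#
  2≢0 2≡0 = -1≢1 {k ℕ.* 2} n≡2k*2 (sym (x+y≡0⇒x≡-y 1# 1# 2≡0))

  -- With ζ a primitive 8th root of unity, (ζ + ζ⁷)² = ζ² + 2ζ⁸ + ζ¹⁴ = 2.
  2-square : ∀ {j} → n ≡ j ℕ.* 8 → Square (1# + 1#)
  2-square {j} n≡8j = b ℕ.+ b , trans 2≡w² (trans (cong (λ u → u * u) (sym α^b≡w)) (sym (^-homo-+ α b b))) ,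
                      trans (cong (_% 2) (m+m≡m*2 b)) (m*n%n≡0 b 2)
    where
    ζ : F
    ζ = α ^ j
    ζ⁴≡-1 : ζ ^ 4 ≡ - 1#
    ζ⁴≡-1 = trans (sym (^-*-assoc α j 4)) (α^m≡-1 {j ℕ.* 4} (trans n≡8j (sym (ℕP.*-assoc j 4 2))))
    ζ⁸≡1 : ζ ^ 8 ≡ 1#
    ζ⁸≡1 = begin
      ζ ^ 8               ≡⟨ ^-homo-+ ζ 4 4 ⟩
      ζ ^ 4 * ζ ^ 4       ≡⟨ cong₂ _*_ ζ⁴≡-1 ζ⁴≡-1 ⟩
      - 1# * - 1#         ≡⟨ -1*x≈-x (- 1#) ⟩
      - - 1#              ≡⟨ -‿involutive 1# ⟩
      1#                  ∎
    ζ⁷*ζ⁷≡-ζ² : ζ ^ 7 * ζ ^ 7 ≡ - (ζ ^ 2)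
    ζ⁷*ζ⁷≡-ζ² = begin
      ζ ^ 7 * ζ ^ 7       ≡⟨ ^-homo-+ ζ 7 7 ⟨
      ζ ^ 14              ≡⟨ ^-homo-+ ζ 8 6 ⟩
      ζ ^ 8 * ζ ^ 6       ≡⟨ cong (_* ζ ^ 6) ζ⁸≡1 ⟩
      1# * ζ ^ 6          ≡⟨ *-identityˡ _ ⟩
      ζ ^ 6               ≡⟨ ^-homo-+ ζ 4 2 ⟩
      ζ ^ 4 * ζ ^ 2       ≡⟨ cong (_* ζ ^ 2) ζ⁴≡-1 ⟩
      - 1# * ζ ^ 2        ≡⟨ -1*x≈-x (ζ ^ 2) ⟩
      - (ζ ^ 2)           ∎
    w : F
    w = ζ + ζ ^ 7
    2≡w² : 1# + 1# ≡ w * w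
    2≡w² = sym (begin
      (ζ + ζ ^ 7) * (ζ + ζ ^ 7)                        ≡⟨ solve 2 (λ a b → ((a ⊕ b) ⊗ (a ⊕ b)) ⊜ (((a ⊗ a) ⊕ ((a ⊗ b) ⊕ (a ⊗ b))) ⊕ (b ⊗ b))) refl ζ (ζ ^ 7) ⟩
      ζ * ζ + (ζ ^ 8 + ζ ^ 8) + ζ ^ 7 * ζ ^ 7          ≡⟨ cong₂ (λ u v → u + (ζ ^ 8 + ζ ^ 8) + v) (cong (ζ *_) (sym (*-identityʳ ζ))) ζ⁷*ζ⁷≡-ζ² ⟩
      ζ ^ 2 + (ζ ^ 8 + ζ ^ 8) - ζ ^ 2                  ≡⟨ cong (λ u → ζ ^ 2 + (u + u) - ζ ^ 2) ζ⁸≡1 ⟩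
      ζ ^ 2 + (1# + 1#) - ζ ^ 2                        ≡⟨ cong (_- ζ ^ 2) (+-comm (ζ ^ 2) _) ⟩
      1# + 1# + ζ ^ 2 - ζ ^ 2                          ≡⟨ x+y-y≡x _ (ζ ^ 2) ⟩
      1# + 1#                                          ∎)
    w≢0 : w ≢ 0#
    w≢0 w≡0 = 2≢0 (trans 2≡w² (trans (cong (_* w) w≡0) (zeroˡ w)))
    b : ℕ
    b = proj₁ (proj₂ α-primitive w w≢0)
    α^b≡w : α ^ b ≡ w
    α^b≡w = proj₂ (proj₂ α-primitive w w≢0)

  InClass₂-*-square : ∀ {c x y} → c < 2 → InClass 2 c x → Square y → InClass 2 c (x * y)
  InClass₂-*-square {c} c<2 x∈ y∈ = InClass-* 2 x∈ y∈ (trans (cong (_% 2) (ℕP.+-identityʳ c)) (m<n⇒m%n≡m c<2))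

  square-*-InClass₂ : ∀ {c x y} → c < 2 → Square x → InClass 2 c y → InClass 2 c (x * y)
  square-*-InClass₂ c<2 x∈ y∈ = InClass-* 2 x∈ y∈ (m<n⇒m%n≡m c<2)

  InClass₂-*-same : ∀ {c x y} → c < 2 → InClass 2 c x → InClass 2 c y → Square (x * y)
  InClass₂-*-same {0}           _ x∈ y∈ = InClass-* 2 x∈ y∈ refl
  InClass₂-*-same {1}           _ x∈ y∈ = InClass-* 2 x∈ y∈ refl
  InClass₂-*-same {suc (suc _)} (s≤s (s≤s ())) _ _

  -- For h = 1 the length of this list is the cyclotomic number (c₀, c₁) of order 2.
  solutions : ℕ → ℕ → F → List F
  solutions c₀ c₁ h = filter (λ u → (u + h) ∈? C α 2 c₁) (C α 2 c₀)

  module _ {c₀ c₁} (c₀<2 : c₀ < 2) (c₁<2 : c₁ < 2) (h : F) where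

    ∈-solutions⁻ : ∀ {u} → u ∈ solutions c₀ c₁ h → InClass 2 c₀ u × InClass 2 c₁ (u + h)
    ∈-solutions⁻ u∈ with ∈-filter⁻ (λ u → (u + h) ∈? C α 2 c₁) {xs = C α 2 c₀} u∈
    ... | u∈C , u+h∈C = ∈C⇒InClass 2 c₀<2 u∈C , ∈C⇒InClass 2 c₁<2 u+h∈C

    ∈-solutions⁺ : ∀ {u} → InClass 2 c₀ u → InClass 2 c₁ (u + h) → u ∈ solutions c₀ c₁ h
    ∈-solutions⁺ u∈ u+h∈ =
      ∈-filter⁺ (λ u → (u + h) ∈? C α 2 c₁) (InClass⇒∈C 2 2∣n c₀<2 u∈) (InClass⇒∈C 2 2∣n c₁<2 u+h∈)

    unique-solutions : Unique (solutions c₀ c₁ h)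
    unique-solutions = Unique.filter⁺ (λ u → (u + h) ∈? C α 2 c₁) (unique-C 2 2∣n c₀<2)

  length-solutions-≡ : ∀ {c₀ c₁ h c₀′ c₁′ h′} (c₀<2 : c₀ < 2) (c₁<2 : c₁ < 2) (c₀′<2 : c₀′ < 2) (c₁′<2 : c₁′ < 2)
    (f g : F → F) →
    (∀ {u} → InClass 2 c₀ u → InClass 2 c₁ (u + h) → InClass 2 c₀′ (f u) × InClass 2 c₁′ (f u + h′)) →
    (∀ {v} → InClass 2 c₀′ v → InClass 2 c₁′ (v + h′) → InClass 2 c₀ (g v) × InClass 2 c₁ (g v + h)) →
    (∀ {u} → InClass 2 c₀ u → g (f u) ≡ u) → (∀ {v} → InClass 2 c₀′ v → f (g v) ≡ v) →
    length (solutions c₀ c₁ h) ≡ length (solutions c₀′ c₁′ h′)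
  length-solutions-≡ {h = h} {h′ = h′} c₀<2 c₁<2 c₀′<2 c₁′<2 f g f-sol g-sol gf fg =
    length-bijection (unique-solutions c₀<2 c₁<2 h) (unique-solutions c₀′<2 c₁′<2 h′) f g
      (λ u∈ → let u-sol = ∈-solutions⁻ c₀<2 c₁<2 h u∈ ; fu-sol = f-sol (proj₁ u-sol) (proj₂ u-sol)
              in ∈-solutions⁺ c₀′<2 c₁′<2 h′ (proj₁ fu-sol) (proj₂ fu-sol))
      (λ v∈ → let v-sol = ∈-solutions⁻ c₀′<2 c₁′<2 h′ v∈ ; gv-sol = g-sol (proj₁ v-sol) (proj₂ v-sol)
              in ∈-solutions⁺ c₀<2 c₁<2 h (proj₁ gv-sol) (proj₂ gv-sol))
      (gf ∘ proj₁ ∘ ∈-solutions⁻ c₀<2 c₁<2 h)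
      (fg ∘ proj₁ ∘ ∈-solutions⁻ c₀′<2 c₁′<2 h′)

  -- Scaling by g⁻¹ moves the equation u + g = w to the equation u′ + 1 = w′.
  solutions-scale : ∀ {c g} → c < 2 → InClass 2 c g → length (solutions 0 0 g) ≡ length (solutions c c 1#)
  solutions-scale {c} {g} c<2 g∈ = length-solutions-≡ 0<2 0<2 c<2 c<2 (_* g ⁻¹) (_* g)
    (λ u∈ u+g∈ → square-*-InClass₂ c<2 u∈ g⁻¹∈ , subst (InClass 2 c) (scaled _) (square-*-InClass₂ c<2 u+g∈ g⁻¹∈))
    (λ v∈ v+1∈ → InClass₂-*-same c<2 v∈ g∈ , subst Square (unscaled _) (InClass₂-*-same c<2 v+1∈ g∈))
    (λ _ → x*y⁻¹*y≡x g≢0) (λ _ → x*y*y⁻¹≡x g≢0)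
    where
    g≢0 : g ≢ 0#
    g≢0 = InClass-nonzero 2 g∈
    g⁻¹∈ : InClass 2 c (g ⁻¹)
    g⁻¹∈ = InClass₂-⁻¹ 2∣n g∈
    scaled : ∀ u → (u + g) * g ⁻¹ ≡ u * g ⁻¹ + 1#
    scaled u = trans (distribʳ (g ⁻¹) u g) (cong (u * g ⁻¹ +_) (x*x⁻¹≡1 g≢0))
    unscaled : ∀ v → (v + 1#) * g ≡ v * g + g
    unscaled v = trans (distribʳ g v 1#) (cong (v * g +_) (*-identityˡ g))

  private
    reflect : F → F
    reflect u = - (u + 1#)

    reflect+1 : ∀ u → reflect u + 1# ≡ - u
    reflect+1 u = begin
      - (u + 1#) + 1#        ≡⟨ cong (_+ 1#) (-x+-y≡-[x+y] u 1#) ⟨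
      - u + - 1# + 1#        ≡⟨ +-assoc (- u) (- 1#) 1# ⟩
      - u + (- 1# + 1#)      ≡⟨ cong (- u +_) (-‿inverseˡ 1#) ⟩
      - u + 0#               ≡⟨ +-identityʳ _ ⟩
      - u                    ∎

    reflect-involutive : ∀ u → reflect (reflect u) ≡ u
    reflect-involutive u = trans (cong -_ (reflect+1 u)) (-‿involutive u)

  -‿InClass₂ : ∀ {c u} → c < 2 → InClass 2 c u → InClass 2 c (- u)
  -‿InClass₂ c<2 u∈ = subst (InClass 2 _) (-1*x≈-x _) (square-*-InClass₂ c<2 -1-square u∈)

  -- u ↦ -(u + 1) swaps u and u + 1 up to the square factor -1.
  N₀₁≡N₁₀ : length (solutions 0 1 1#) ≡ length (solutions 1 0 1#)
  N₀₁≡N₁₀ = length-solutions-≡ 0<2 1<2 1<2 0<2 reflect reflect (swap 0<2 1<2) (swap 1<2 0<2)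
    (λ {u} _ → reflect-involutive u) (λ {v} _ → reflect-involutive v)
    where
    swap : ∀ {c₀ c₁ u} → c₀ < 2 → c₁ < 2 → InClass 2 c₀ u → InClass 2 c₁ (u + 1#) →
           InClass 2 c₁ (reflect u) × InClass 2 c₀ (reflect u + 1#)
    swap c₀<2 c₁<2 u∈ u+1∈ =
      -‿InClass₂ c₁<2 u+1∈ , subst (InClass 2 _) (sym (reflect+1 _)) (-‿InClass₂ c₀<2 u∈)

  N₁₀≡N₁₁ : length (solutions 1 0 1#) ≡ length (solutions 1 1 1#)
  N₁₀≡N₁₁ = length-solutions-≡ 1<2 0<2 1<2 1<2 _⁻¹ _⁻¹
    (λ u∈ u+1∈ → InClass₂-⁻¹ 2∣n u∈ , subst NonSquare (u⁻¹+1 u∈) (square-*-InClass₂ 1<2 u+1∈ (InClass₂-⁻¹ 2∣n u∈)))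
    (λ v∈ v+1∈ → InClass₂-⁻¹ 2∣n v∈ , subst Square (u⁻¹+1 v∈) (InClass₂-*-same 1<2 v+1∈ (InClass₂-⁻¹ 2∣n v∈)))
    (⁻¹-involutive ∘ InClass-nonzero 2) (⁻¹-involutive ∘ InClass-nonzero 2)
    where
    u⁻¹+1 : ∀ {u} → InClass 2 1 u → (u + 1#) * u ⁻¹ ≡ u ⁻¹ + 1#
    u⁻¹+1 {u} u∈ = trans (distribʳ (u ⁻¹) u 1#)
      (trans (cong₂ _+_ (x*x⁻¹≡1 (InClass-nonzero 2 u∈)) (*-identityˡ (u ⁻¹))) (+-comm 1# (u ⁻¹)))

  solutions-partition : ∀ {c₀} → c₀ < 2 → (R : List F) → Unique R →
    (∀ {u} → u ∈ R → InClass 2 c₀ u × u + 1# ≢ 0#) → (∀ {u} → InClass 2 c₀ u → u + 1# ≢ 0# → u ∈ R) →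
    length (solutions c₀ 0 1#) ℕ.+ length (solutions c₀ 1 1#) ≡ length R
  solutions-partition {c₀} c₀<2 R unique-R R⁻ R⁺ = begin
    length (solutions c₀ 0 1#) ℕ.+ length (solutions c₀ 1 1#)   ≡⟨ length-++ (solutions c₀ 0 1#) ⟨
    length (solutions c₀ 0 1# ++ solutions c₀ 1 1#)            ≡⟨ unique-length-≡ unique-++ unique-R (mk⇔ to from) ⟩
    length R                                                   ∎
    where
    unique-++ : Unique (solutions c₀ 0 1# ++ solutions c₀ 1 1#)
    unique-++ = Unique.++⁺ (unique-solutions c₀<2 0<2 1#) (unique-solutions c₀<2 1<2 1#)
      λ (u∈₀ , u∈₁) → ¬square∧nonSquare (proj₂ (∈-solutions⁻ c₀<2 0<2 1# u∈₀)) (proj₂ (∈-solutions⁻ c₀<2 1<2 1# u∈₁))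
    to : ∀ {u} → u ∈ solutions c₀ 0 1# ++ solutions c₀ 1 1# → u ∈ R
    to u∈ with ∈-++⁻ (solutions c₀ 0 1#) u∈
    ... | inj₁ u∈₀ = let u∈ , u+1∈ = ∈-solutions⁻ c₀<2 0<2 1# u∈₀ in R⁺ u∈ (InClass-nonzero 2 u+1∈)
    ... | inj₂ u∈₁ = let u∈ , u+1∈ = ∈-solutions⁻ c₀<2 1<2 1# u∈₁ in R⁺ u∈ (InClass-nonzero 2 u+1∈)
    from : ∀ {u} → u ∈ R → u ∈ solutions c₀ 0 1# ++ solutions c₀ 1 1#
    from u∈R with R⁻ u∈R
    ... | u∈ , u+1≢0 with square⊎nonSquare u+1≢0
    ...   | inj₁ u+1∈ = ∈-++⁺ˡ (∈-solutions⁺ c₀<2 0<2 1# u∈ u+1∈)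
    ...   | inj₂ u+1∈ = ∈-++⁺ʳ (solutions c₀ 0 1#) (∈-solutions⁺ c₀<2 1<2 1# u∈ u+1∈)

  length-C₂ : ∀ c → length (C α 2 c) ≡ k ℕ.* 2
  length-C₂ c = length-C 2 {c} (trans n≡2k*2 (ℕP.*-comm (k ℕ.* 2) 2))

  -- Only u = -1 (a square) is excluded by u + 1 ≠ 0.
  1+N₀₀+N₀₁≡2k : suc (length (solutions 0 0 1#) ℕ.+ length (solutions 0 1 1#)) ≡ k ℕ.* 2
  1+N₀₀+N₀₁≡2k = begin
    suc (length (solutions 0 0 1#) ℕ.+ length (solutions 0 1 1#))
      ≡⟨ cong suc (solutions-partition 0<2 squares′ (unique-remove _≟_ unique-squares) R⁻ R⁺) ⟩
    suc (length squares′)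
      ≡⟨ length-remove _≟_ unique-squares (InClass⇒∈C 2 2∣n 0<2 -1-square) ⟩
    length (C α 2 0)
      ≡⟨ length-C₂ 0 ⟩
    k ℕ.* 2 ∎
    where
    unique-squares : Unique (C α 2 0)
    unique-squares = unique-C 2 2∣n 0<2
    squares′ : List F
    squares′ = remove _≟_ (- 1#) (C α 2 0)
    R⁻ : ∀ {u} → u ∈ squares′ → Square u × u + 1# ≢ 0#
    R⁻ u∈ = let u∈C , -1≢u = ∈-remove⁻ _≟_ (C α 2 0) u∈
            in ∈C⇒InClass 2 0<2 u∈C , -1≢u ∘ sym ∘ x+y≡0⇒x≡-y _ 1#
    R⁺ : ∀ {u} → Square u → u + 1# ≢ 0# → u ∈ squares′
    R⁺ u∈ u+1≢0 = ∈-remove⁺ _≟_ (InClass⇒∈C 2 2∣n 0<2 u∈) λ -1≡u → u+1≢0 (trans (cong (_+ 1#) (sym -1≡u)) (-‿inverseˡ 1#))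

  N₁₀+N₁₁≡2k : length (solutions 1 0 1#) ℕ.+ length (solutions 1 1 1#) ≡ k ℕ.* 2
  N₁₀+N₁₁≡2k = trans (solutions-partition 1<2 (C α 2 1) (unique-C 2 2∣n 1<2) R⁻ (λ u∈ _ → InClass⇒∈C 2 2∣n 1<2 u∈)) (length-C₂ 1)
    where
    R⁻ : ∀ {u} → u ∈ C α 2 1 → NonSquare u × u + 1# ≢ 0#
    R⁻ u∈C = let u∈ = ∈C⇒InClass 2 1<2 u∈C
             in u∈ , λ u+1≡0 → ¬square∧nonSquare (subst Square (sym (x+y≡0⇒x≡-y _ 1# u+1≡0)) -1-square) u∈

  N₁₁≡k : length (solutions 1 1 1#) ≡ k
  N₁₁≡k = ℕP.*-cancelʳ-≡ N₁₁ k 2 (trans (sym (m+m≡m*2 N₁₁)) (trans (cong (ℕ._+ N₁₁) (sym N₁₀≡N₁₁)) N₁₀+N₁₁≡2k))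
    where
    N₁₁ : ℕ
    N₁₁ = length (solutions 1 1 1#)

  N₀₀≡k∸1 : length (solutions 0 0 1#) ≡ k ℕ.∸ 1
  N₀₀≡k∸1 = cong ℕ.pred (ℕP.+-cancelʳ-≡ k _ k (begin
    suc (length (solutions 0 0 1#)) ℕ.+ k                              ≡⟨ cong (λ w → suc (length (solutions 0 0 1#) ℕ.+ w)) N₀₁≡k ⟨
    suc (length (solutions 0 0 1#) ℕ.+ length (solutions 0 1 1#))     ≡⟨ 1+N₀₀+N₀₁≡2k ⟩
    k ℕ.* 2                                                           ≡⟨ m+m≡m*2 k ⟨
    k ℕ.+ k                                                           ∎))
    where
    N₀₁≡k : length (solutions 0 1 1#) ≡ k
    N₀₁≡k = trans N₀₁≡N₁₀ (trans N₁₀≡N₁₁ N₁₁≡k)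

  squares-shifted-by-square : ∀ {g} → Square g → length (solutions 0 0 g) ≡ k ℕ.∸ 1
  squares-shifted-by-square g∈ = trans (solutions-scale 0<2 g∈) N₀₀≡k∸1

  squares-shifted-by-nonSquare : ∀ {g} → NonSquare g → length (solutions 0 0 g) ≡ k
  squares-shifted-by-nonSquare g∈ = trans (solutions-scale 1<2 g∈) N₁₁≡k

module DifferencePairs (K : FiniteField) {m : ℕ} (D : Fin m → List (FiniteField.F K))
                       (unique-D : ∀ i → Unique (D i))
                       (disjoint-D : ∀ i j → i ≢ j → ∀ x → x ∈ D i → x ∉ D j) where

  open FieldProperties K

  difference : F × F → F
  difference (x , y) = x - y

  -- Same case split as the local function of Defs.Δ, so that Δ unfolds to map difference.
  distinctPair : F → F → List (F × F)
  distinctPair x y with x ≟ y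
  ... | yes _ = []
  ... | no  _ = (x , y) ∷ []

  blockPairs : List F → List (F × F)
  blockPairs A = concatMap (λ x → concatMap (distinctPair x) A) A

  crossPairs : Fin m → Fin m → List (F × F)
  crossPairs i j with i FinP.≟ j
  ... | yes _ = []
  ... | no  _ = cartesianProduct (D i) (D j)

  internalPairs externalPairs : List (F × F)
  internalPairs = concatMap (blockPairs ∘ D) (allFin m)
  externalPairs = concatMap (λ i → concatMap (crossPairs i) (allFin m)) (allFin m)

  private
    -- The type of the pointwise equation is left for Agda to infer from its use, since the
    -- local function of Defs.Δ cannot be named.
    mutual
      Δ≡concatMap-differences : ∀ A → Δ A ≡ concatMap (λ x → concatMap (map difference ∘ distinctPair x) A) A
      Δ≡concatMap-differences A = concatMap-cong (λ x → concatMap-cong (Δ-pointwise A x) A) A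

      Δ-pointwise : ∀ (A : List F) x y → _ ≡ map difference (distinctPair x y)
      Δ-pointwise A x y with x ≟ y
      ... | yes _ = refl
      ... | no  _ = refl

    Δ≡map-difference : ∀ A → Δ A ≡ map difference (blockPairs A)
    Δ≡map-difference A = begin
      Δ A                                                                    ≡⟨ Δ≡concatMap-differences A ⟩
      concatMap (λ x → concatMap (map difference ∘ distinctPair x) A) A    ≡⟨ concatMap-cong (λ x → map-concatMap difference (distinctPair x) A) A ⟨
      concatMap (λ x → map difference (concatMap (distinctPair x) A)) A    ≡⟨ map-concatMap difference (λ x → concatMap (distinctPair x) A) A ⟨
      map difference (blockPairs A)                                        ∎
      where open ≡-Reasoning

    Δ₂≡map-difference : ∀ A B → Δ₂ A B ≡ map difference (cartesianProduct A B)
    Δ₂≡map-difference []      B = refl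
    Δ₂≡map-difference (x ∷ A) B = begin
      map (λ y → x - y) B ++ Δ₂ A B                                            ≡⟨ cong₂ _++_ (map-∘ B) (Δ₂≡map-difference A B) ⟩
      map difference (map (x ,_) B) ++ map difference (cartesianProduct A B) ≡⟨ map-++ difference (map (x ,_) B) _ ⟨
      map difference (cartesianProduct (x ∷ A) B)                         ∎
      where open ≡-Reasoning

  ΔDisj≡map-difference : ΔDisj D ≡ map difference internalPairs
  ΔDisj≡map-difference = trans (concatMap-cong (Δ≡map-difference ∘ D) (allFin m))
                               (sym (map-concatMap difference (blockPairs ∘ D) (allFin m)))

  private
    mutual
      ΔExt≡concatMap-differences : ΔExt D ≡ concatMap (λ i → concatMap (map difference ∘ crossPairs i) (allFin m)) (allFin m)
      ΔExt≡concatMap-differences = concatMap-cong (λ i → concatMap-cong (ΔExt-pointwise i) (allFin m)) (allFin m)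

      ΔExt-pointwise : ∀ i j → _ ≡ map difference (crossPairs i j)
      ΔExt-pointwise i j with i FinP.≟ j
      ... | yes _ = refl
      ... | no  _ = Δ₂≡map-difference (D i) (D j)

  ΔExt≡map-difference : ΔExt D ≡ map difference externalPairs
  ΔExt≡map-difference = begin
    ΔExt D                                                                                 ≡⟨ ΔExt≡concatMap-differences ⟩
    concatMap (λ i → concatMap (map difference ∘ crossPairs i) (allFin m)) (allFin m)    ≡⟨ concatMap-cong (λ i → map-concatMap difference (crossPairs i) (allFin m)) (allFin m) ⟨
    concatMap (λ i → map difference (concatMap (crossPairs i) (allFin m))) (allFin m)    ≡⟨ map-concatMap difference (λ i → concatMap (crossPairs i) (allFin m)) (allFin m) ⟨
    map difference externalPairs                                                         ∎
    where open ≡-Reasoning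

  same-block : ∀ {i j x} → x ∈ D i → x ∈ D j → i ≡ j
  same-block {i} {j} {x} x∈Dᵢ x∈Dⱼ with i FinP.≟ j
  ... | yes i≡j = i≡j
  ... | no  i≢j = ⊥-elim (disjoint-D i j i≢j x x∈Dᵢ x∈Dⱼ)

  private
    ∈-distinctPair⁻ : ∀ {x y p} → p ∈ distinctPair x y → p ≡ (x , y) × x ≢ y
    ∈-distinctPair⁻ {x} {y} p∈ with x ≟ y | p∈
    ... | no x≢y | here refl = refl , x≢y

    ∈-distinctPair⁺ : ∀ {x y} → x ≢ y → (x , y) ∈ distinctPair x y
    ∈-distinctPair⁺ {x} {y} x≢y with x ≟ y
    ... | yes x≡y = ⊥-elim (x≢y x≡y)
    ... | no  _   = here refl

    unique-distinctPair : ∀ x y → Unique (distinctPair x y)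
    unique-distinctPair x y with x ≟ y
    ... | yes _ = []
    ... | no  _ = All.[] ∷ []

    ∈-blockPairs⁻ : ∀ {A x y} → (x , y) ∈ blockPairs A → x ∈ A × y ∈ A × x ≢ y
    ∈-blockPairs⁻ {A} p∈ with ∈-concatMap⁻′ (λ x → concatMap (distinctPair x) A) {A} p∈
    ... | x′ , x′∈ , p∈′ with ∈-concatMap⁻′ (distinctPair x′) {A} p∈′
    ...   | y′ , y′∈ , p∈″ with ∈-distinctPair⁻ p∈″
    ...     | refl , x≢y = x′∈ , y′∈ , x≢y

    unique-blockPairs : ∀ {A} → Unique A → Unique (blockPairs A)
    unique-blockPairs {A} u = unique-concatMap⁺ (λ x → concatMap (distinctPair x) A) u
      (λ {x} _ → unique-concatMap⁺ (distinctPair x) u (λ _ → unique-distinctPair x _)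
        λ _ _ y≢y′ p∈ p∈′ → y≢y′ (cong proj₂ (trans (sym (proj₁ (∈-distinctPair⁻ p∈))) (proj₁ (∈-distinctPair⁻ p∈′)))))
      λ _ _ x≢x′ p∈ p∈′ → x≢x′ (trans (sym (first p∈)) (first p∈′))
      where
      first : ∀ {x p} → p ∈ concatMap (distinctPair x) A → proj₁ p ≡ x
      first {x} p∈ with ∈-concatMap⁻′ (distinctPair x) {A} p∈
      ... | _ , _ , p∈′ = cong proj₁ (proj₁ (∈-distinctPair⁻ p∈′))

    ∈-crossPairs⁻ : ∀ {i j x y} → (x , y) ∈ crossPairs i j → i ≢ j × x ∈ D i × y ∈ D j
    ∈-crossPairs⁻ {i} {j} p∈ with i FinP.≟ j
    ... | no i≢j = i≢j , ∈-cartesianProduct⁻ (D i) (D j) p∈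

    ∈-crossPairs⁺ : ∀ {i j x y} → i ≢ j → x ∈ D i → y ∈ D j → (x , y) ∈ crossPairs i j
    ∈-crossPairs⁺ {i} {j} i≢j x∈ y∈ with i FinP.≟ j
    ... | yes i≡j = ⊥-elim (i≢j i≡j)
    ... | no  _   = ∈-cartesianProduct⁺ x∈ y∈

    unique-crossPairs : ∀ i j → Unique (crossPairs i j)
    unique-crossPairs i j with i FinP.≟ j
    ... | yes _ = []
    ... | no  _ = Unique.cartesianProduct⁺ (unique-D i) (unique-D j)

  ∈-internalPairs⁻ : ∀ {x y} → (x , y) ∈ internalPairs → ∃ λ i → x ∈ D i × y ∈ D i × x ≢ y
  ∈-internalPairs⁻ p∈ with ∈-concatMap⁻′ (blockPairs ∘ D) {allFin m} p∈
  ... | i , _ , p∈′ = i , ∈-blockPairs⁻ p∈′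

  ∈-internalPairs⁺ : ∀ {i x y} → x ∈ D i → y ∈ D i → x ≢ y → (x , y) ∈ internalPairs
  ∈-internalPairs⁺ {i} {x} {y} x∈ y∈ x≢y = ∈-concatMap⁺′ (blockPairs ∘ D) (∈-allFin i)
    (∈-concatMap⁺′ (λ x → concatMap (distinctPair x) (D i)) x∈
      (∈-concatMap⁺′ (distinctPair x) y∈ (∈-distinctPair⁺ x≢y)))

  unique-internalPairs : Unique internalPairs
  unique-internalPairs = unique-concatMap⁺ (blockPairs ∘ D) (Unique.allFin⁺ m) (λ {i} _ → unique-blockPairs (unique-D i))
    λ {i} {i′} _ _ i≢i′ p∈ p∈′ → i≢i′ (same-block (proj₁ (∈-blockPairs⁻ p∈)) (proj₁ (∈-blockPairs⁻ p∈′)))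

  ∈-externalPairs⁻ : ∀ {x y} → (x , y) ∈ externalPairs → ∃₂ λ i j → i ≢ j × x ∈ D i × y ∈ D j
  ∈-externalPairs⁻ p∈ with ∈-concatMap⁻′ (λ i → concatMap (crossPairs i) (allFin m)) {allFin m} p∈
  ... | i , _ , p∈′ with ∈-concatMap⁻′ (crossPairs i) {allFin m} p∈′
  ...   | j , _ , p∈″ = i , j , ∈-crossPairs⁻ p∈″

  ∈-externalPairs⁺ : ∀ {i j x y} → i ≢ j → x ∈ D i → y ∈ D j → (x , y) ∈ externalPairs
  ∈-externalPairs⁺ {i} {j} i≢j x∈ y∈ = ∈-concatMap⁺′ (λ i → concatMap (crossPairs i) (allFin m)) (∈-allFin i)
    (∈-concatMap⁺′ (crossPairs i) (∈-allFin j) (∈-crossPairs⁺ i≢j x∈ y∈))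

  unique-externalPairs : Unique externalPairs
  unique-externalPairs = unique-concatMap⁺ (λ i → concatMap (crossPairs i) (allFin m)) (Unique.allFin⁺ m)
    (λ {i} _ → unique-concatMap⁺ (crossPairs i) (Unique.allFin⁺ m) (λ {j} _ → unique-crossPairs i j)
      λ {j} {j′} _ _ j≢j′ p∈ p∈′ →
        j≢j′ (same-block (proj₂ (proj₂ (∈-crossPairs⁻ {i} p∈))) (proj₂ (proj₂ (∈-crossPairs⁻ {i} p∈′)))))
    λ {i} {i′} _ _ i≢i′ p∈ p∈′ → i≢i′ (same-block (first-block p∈) (first-block p∈′))
    where
    first-block : ∀ {i x y} → (x , y) ∈ concatMap (crossPairs i) (allFin m) → x ∈ D i
    first-block {i} p∈ with ∈-concatMap⁻′ (crossPairs i) {allFin m} p∈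
    ... | j , _ , p∈′ = proj₁ (proj₂ (∈-crossPairs⁻ p∈′))

  differencesEqualTo : F → List (F × F) → List (F × F)
  differencesEqualTo g = filter ((g ≟_) ∘ difference)

  ∈-differencesEqualTo⁻ : ∀ {g p L} → p ∈ differencesEqualTo g L → p ∈ L × g ≡ difference p
  ∈-differencesEqualTo⁻ {g} {L = L} = ∈-filter⁻ ((g ≟_) ∘ difference) {xs = L}

  ∈-differencesEqualTo⁺ : ∀ {g p L} → p ∈ L → g ≡ difference p → p ∈ differencesEqualTo g L
  ∈-differencesEqualTo⁺ {g} = ∈-filter⁺ ((g ≟_) ∘ difference)

  unique-differencesEqualTo : ∀ {g L} → Unique L → Unique (differencesEqualTo g L)
  unique-differencesEqualTo {g} = Unique.filter⁺ ((g ≟_) ∘ difference)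

  count-ΔDisj : ∀ g → count g (ΔDisj D) ≡ length (differencesEqualTo g internalPairs)
  count-ΔDisj g = trans (cong (count g) ΔDisj≡map-difference) (count-map _≟_ g difference internalPairs)

  count-ΔExt : ∀ g → count g (ΔExt D) ≡ length (differencesEqualTo g externalPairs)
  count-ΔExt g = trans (cong (count g) ΔExt≡map-difference) (count-map _≟_ g difference externalPairs)

  count-0-ΔDisj : count 0# (ΔDisj D) ≡ 0
  count-0-ΔDisj = trans (count-ΔDisj 0#) (cong length (filter-none ((0# ≟_) ∘ difference) (All.tabulate
    λ p∈ 0≡x-y → let _ , _ , _ , x≢y = ∈-internalPairs⁻ p∈ in x≢y (x-y≡0⇒x≡y _ _ (sym 0≡x-y)))))

  count-0-ΔExt : count 0# (ΔExt D) ≡ 0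
  count-0-ΔExt = trans (count-ΔExt 0#) (cong length (filter-none ((0# ≟_) ∘ difference) (All.tabulate
    λ p∈ 0≡x-y → let _ , j , i≢j , x∈ , y∈ = ∈-externalPairs⁻ p∈
                 in i≢j (same-block x∈ (subst (_∈ D j) (sym (x-y≡0⇒x≡y _ _ (sym 0≡x-y))) y∈)))))

module SquareFamily (K : FiniteField) (α : FiniteField.F K) (α-primitive : FiniteField.IsPrimitive K α)
                    (e f : ℕ) (order≡ef+1 : FiniteField.order K ≡ e ℕ.* f ℕ.+ 1)
                    (order%4≡1 : FiniteField.order K % 4 ≡ 1) (e%2≡0 : e % 2 ≡ 0) where

  private
    k : ℕ
    k = FiniteField.order K / 4

    n≡k*4 : FiniteField.order K ℕ.∸ 1 ≡ k ℕ.* 4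
    n≡k*4 = m∸1≡r+[m/d]*d {FiniteField.order K} {4} order%4≡1

  open Squares K α α-primitive k n≡k*4 public
  open ≡-Reasoning

  n≡e*f : n ≡ e ℕ.* f
  n≡e*f = trans (cong (ℕ._∸ 1) order≡ef+1) (ℕP.m+n∸n≡m (e ℕ.* f) 1)

  instance
    e-nonZero : NonZero e
    e-nonZero = ℕ.≢-nonZero λ e≡0 → ℕ.≢-nonZero⁻¹ n (trans n≡e*f (cong (ℕ._* f) e≡0))

  e∣n : e ∣ n
  e∣n = divides f (trans n≡e*f (ℕP.*-comm e f))

  e≡2*[e/2] : e ≡ 2 ℕ.* (e / 2)
  e≡2*[e/2] = trans (m≡m%n+[m/n]*n e 2) (trans (cong (ℕ._+ (e / 2) ℕ.* 2) e%2≡0) (ℕP.*-comm (e / 2) 2))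

  2∣e : 2 ∣ e
  2∣e = divides (e / 2) (trans e≡2*[e/2] (ℕP.*-comm 2 (e / 2)))

  D : Fin (e / 2) → List F
  D j = C α e (2 ℕ.* toℕ j)

  private
    2j<e : ∀ (j : Fin (e / 2)) → 2 ℕ.* toℕ j < e
    2j<e j = subst (2 ℕ.* toℕ j <_) (sym e≡2*[e/2]) (ℕP.*-monoʳ-< 2 (FinP.toℕ<n j))

  ∈D⇒InClass : ∀ j {z} → z ∈ D j → InClass e (2 ℕ.* toℕ j) z
  ∈D⇒InClass j = ∈C⇒InClass e (2j<e j)

  InClass⇒∈D : ∀ j {z} → InClass e (2 ℕ.* toℕ j) z → z ∈ D j
  InClass⇒∈D j = InClass⇒∈C e e∣n (2j<e j)

  ∈D⇒square : ∀ j {z} → z ∈ D j → Square z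
  ∈D⇒square j {z} z∈ = subst (λ c → InClass 2 c z) (trans (cong (_% 2) (ℕP.*-comm 2 (toℕ j))) (m*n%n≡0 (toℕ j) 2))
                          (InClass-weaken 2∣e (∈D⇒InClass j z∈))

  square⇒∈D : ∀ {z} → Square z → ∃ λ j → z ∈ D j
  square⇒∈D {z} (a , z≡α^a , a%2≡0) = j , InClass⇒∈D j (a , z≡α^a , trans r≡2*[r/2] (cong (2 ℕ.*_) (sym (FinP.toℕ-fromℕ< r/2<e/2))))
    where
    r : ℕ
    r = a % e
    r≡2*[r/2] : r ≡ 2 ℕ.* (r / 2)
    r≡2*[r/2] = trans (m≡m%n+[m/n]*n r 2)
                  (trans (cong (ℕ._+ (r / 2) ℕ.* 2) (trans (m∣n⇒o%n%m≡o%m 2 e a 2∣e) a%2≡0)) (ℕP.*-comm (r / 2) 2))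
    r/2<e/2 : r / 2 < e / 2
    r/2<e/2 = ℕP.*-cancelˡ-< 2 (r / 2) (e / 2) (subst₂ _<_ r≡2*[r/2] e≡2*[e/2] (m%n<n a e))
    j : Fin (e / 2)
    j = Fin.fromℕ< r/2<e/2

  disjoint-D : ∀ i j → i ≢ j → ∀ x → x ∈ D i → x ∉ D j
  disjoint-D i j i≢j x x∈Dᵢ x∈Dⱼ = i≢j (FinP.toℕ-injective (ℕP.*-cancelˡ-≡ (toℕ i) (toℕ j) 2
    (InClass-unique e e∣n (∈D⇒InClass i x∈Dᵢ) (∈D⇒InClass j x∈Dⱼ))))

  unique-D : ∀ j → Unique (D j)
  unique-D j = unique-C e e∣n (2j<e j)

  isFamily : IsFamily (e / 2) f D
  isFamily = (λ j → unique-D j , length-C e {2 ℕ.* toℕ j} n≡e*f , All.tabulate (InClass-nonzero e ∘ ∈D⇒InClass j)) , disjoint-D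

  open DifferencePairs K D unique-D disjoint-D public

  -- Written exactly as in Defs.φ, so that φ α e c is length (Φ c) by definition.
  Φ : ℕ → List F
  Φ c = filter (λ x → ¬? (x ≟ 1#) ×-dec ((x - 1#) ∈? C α 2 c)) (C α e 0)

  module _ {c} (c<2 : c < 2) where

    ∈-Φ⁻ : ∀ {t} → t ∈ Φ c → InClass e 0 t × t ≢ 1# × InClass 2 c (t - 1#)
    ∈-Φ⁻ t∈ = let t∈E , t≢1 , t-1∈ = ∈-filter⁻ (λ x → ¬? (x ≟ 1#) ×-dec ((x - 1#) ∈? C α 2 c)) {xs = C α e 0} t∈
              in ∈C⇒InClass e (ℕ.>-nonZero⁻¹ e) t∈E , t≢1 , ∈C⇒InClass 2 c<2 t-1∈

    ∈-Φ⁺ : ∀ {t} → InClass e 0 t → t ≢ 1# → InClass 2 c (t - 1#) → t ∈ Φ c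
    ∈-Φ⁺ t∈ t≢1 t-1∈ = ∈-filter⁺ (λ x → ¬? (x ≟ 1#) ×-dec ((x - 1#) ∈? C α 2 c))
      (InClass⇒∈C e e∣n (ℕ.>-nonZero⁻¹ e) t∈) (t≢1 , InClass⇒∈C 2 2∣n c<2 t-1∈)

    unique-Φ : Unique (Φ c)
    unique-Φ = Unique.filter⁺ (λ x → ¬? (x ≟ 1#) ×-dec ((x - 1#) ∈? C α 2 c)) (unique-C e e∣n (ℕ.>-nonZero⁻¹ e))

  -- A pair (x, y) with x - y = g in one block corresponds to the ratio t = x/y ∈ Φ_c,
  -- and conversely y = g/(t - 1), x = t y.
  module _ {c g} (c<2 : c < 2) (g∈ : InClass 2 c g) where

    private
      g≢0 : g ≢ 0#
      g≢0 = InClass-nonzero 2 g∈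

      ratio : F × F → F
      ratio (x , y) = x * y ⁻¹

      base : F → F
      base t = g * (t - 1#) ⁻¹

      pair : F → F × F
      pair t = t * base t , base t

      pair-data : ∀ {x y} → (x , y) ∈ differencesEqualTo g internalPairs →
                  g ≡ x - y × ∃ λ i → x ∈ D i × y ∈ D i × x ≢ y
      pair-data p∈ = let p∈′ , g≡x-y = ∈-differencesEqualTo⁻ p∈ in g≡x-y , ∈-internalPairs⁻ p∈′

      ratio-1≡g*y⁻¹ : ∀ {x y} → y ≢ 0# → g ≡ x - y → ratio (x , y) - 1# ≡ g * y ⁻¹
      ratio-1≡g*y⁻¹ y≢0 g≡x-y = trans (x*y⁻¹-1≡[x-y]*y⁻¹ y≢0) (cong (_* _) (sym g≡x-y))

      ratio∈ : ∀ {p} → p ∈ differencesEqualTo g internalPairs → ratio p ∈ Φ c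
      ratio∈ {x , y} p∈ =
        let g≡x-y , i , x∈ , y∈ , x≢y = pair-data p∈
            y≢0 = InClass-nonzero e (∈D⇒InClass i y∈)
        in ∈-Φ⁺ c<2 (InClass-ratio e e∣n (∈D⇒InClass i x∈) (∈D⇒InClass i y∈))
             (λ x*y⁻¹≡1 → x≢y (trans (sym (x*y⁻¹*y≡x y≢0)) (trans (cong (_* y) x*y⁻¹≡1) (*-identityˡ y))))
             (subst (InClass 2 c) (sym (ratio-1≡g*y⁻¹ y≢0 g≡x-y))
               (InClass₂-*-square c<2 g∈ (InClass₂-⁻¹ 2∣n (∈D⇒square i y∈))))

      base-square : ∀ {t} → t ∈ Φ c → Square (base t)
      base-square t∈ = InClass₂-*-same c<2 g∈ (InClass₂-⁻¹ 2∣n (proj₂ (proj₂ (∈-Φ⁻ c<2 t∈))))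

      pair∈ : ∀ {t} → t ∈ Φ c → pair t ∈ differencesEqualTo g internalPairs
      pair∈ {t} t∈ =
        let t∈E , t≢1 , _ = ∈-Φ⁻ c<2 t∈
            j , base∈ = square⇒∈D (base-square t∈)
            b≢0 = InClass-nonzero 2 (base-square t∈)
        in ∈-differencesEqualTo⁺
             (∈-internalPairs⁺ {j} (InClass⇒∈D j (InClass-* e t∈E (∈D⇒InClass j base∈) (m<n⇒m%n≡m (2j<e j)))) base∈
               λ t*b≡b → t≢1 (*-cancelˡ b≢0 (trans (*-comm _ t) (trans t*b≡b (sym (*-identityʳ _))))))
             (sym (begin
               t * base t - base t           ≡⟨ [x-1]*y≡x*y-y t (base t) ⟨
               (t - 1#) * base t             ≡⟨ *-comm _ (base t) ⟩
               g * (t - 1#) ⁻¹ * (t - 1#)    ≡⟨ x*y⁻¹*y≡x (t≢1 ∘ x-y≡0⇒x≡y t 1#) ⟩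
               g                             ∎))

      pair∘ratio : ∀ {p} → p ∈ differencesEqualTo g internalPairs → pair (ratio p) ≡ p
      pair∘ratio {x , y} p∈ = cong₂ _,_ (trans (cong (x * y ⁻¹ *_) base≡y) (x*y⁻¹*y≡x y≢0)) base≡y
        where
        g≡x-y : g ≡ x - y
        g≡x-y = proj₁ (pair-data p∈)
        y≢0 : y ≢ 0#
        y≢0 = let _ , i , _ , y∈ , _ = pair-data p∈ in InClass-nonzero e (∈D⇒InClass i y∈)
        base≡y : base (x * y ⁻¹) ≡ y
        base≡y = begin
          g * (x * y ⁻¹ - 1#) ⁻¹         ≡⟨ cong (λ w → g * w ⁻¹) (ratio-1≡g*y⁻¹ y≢0 g≡x-y) ⟩
          g * (g * y ⁻¹) ⁻¹              ≡⟨ cong (g *_) (⁻¹-distrib-* g≢0 (⁻¹-nonzero y≢0)) ⟩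
          g * (g ⁻¹ * y ⁻¹ ⁻¹)           ≡⟨ cong (λ w → g * (g ⁻¹ * w)) (⁻¹-involutive y≢0) ⟩
          g * (g ⁻¹ * y)                 ≡⟨ *-assoc g (g ⁻¹) y ⟨
          g * g ⁻¹ * y                   ≡⟨ cong (_* y) (x*x⁻¹≡1 g≢0) ⟩
          1# * y                         ≡⟨ *-identityˡ y ⟩
          y                              ∎

      ratio∘pair : ∀ {t} → t ∈ Φ c → ratio (pair t) ≡ t
      ratio∘pair t∈ = x*y*y⁻¹≡x (InClass-nonzero 2 (base-square t∈))

    internal-count : length (differencesEqualTo g internalPairs) ≡ φ α e c
    internal-count = length-bijection
      (unique-differencesEqualTo unique-internalPairs) (unique-Φ c<2) ratio pair
      ratio∈ pair∈ pair∘ratio ratio∘pair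

  -- Every pair of squares x, y with x - y = g is either internal or external.
  module _ {g} (g≢0 : g ≢ 0#) where

    private
      externals internals : List (F × F)
      externals = differencesEqualTo g externalPairs
      internals = differencesEqualTo g internalPairs

      y+g≡x : ∀ {x y} → g ≡ x - y → y + g ≡ x
      y+g≡x {x} {y} g≡x-y = trans (cong (y +_) g≡x-y) (trans (+-comm y _) (x-y+y≡x x y))

      y+g-y≡g : ∀ y → y + g - y ≡ g
      y+g-y≡g y = trans (cong (_- y) (+-comm y g)) (x+y-y≡x g y)

      pair-squares : ∀ {x y} → (x , y) ∈ externals ++ internals → Square x × Square y × y + g ≡ x
      pair-squares p∈ = [ external , internal ]′ (∈-++⁻ externals p∈)
        where
        external : ∀ {x y} → (x , y) ∈ externals → Square x × Square y × y + g ≡ x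
        external p∈ₑ = let p∈′ , g≡x-y = ∈-differencesEqualTo⁻ p∈ₑ
                           i , j , _ , x∈ , y∈ = ∈-externalPairs⁻ p∈′
                       in ∈D⇒square i x∈ , ∈D⇒square j y∈ , y+g≡x g≡x-y
        internal : ∀ {x y} → (x , y) ∈ internals → Square x × Square y × y + g ≡ x
        internal p∈ᵢ = let p∈′ , g≡x-y = ∈-differencesEqualTo⁻ p∈ᵢ
                           i , x∈ , y∈ , _ = ∈-internalPairs⁻ p∈′
                       in ∈D⇒square i x∈ , ∈D⇒square i y∈ , y+g≡x g≡x-y

      unique-pairs : Unique (externals ++ internals)
      unique-pairs = Unique.++⁺ (unique-differencesEqualTo unique-externalPairs) (unique-differencesEqualTo unique-internalPairs)
        λ (p∈ₑ , p∈ᵢ) → let i , j , i≢j , x∈ , y∈ = ∈-externalPairs⁻ (proj₁ (∈-differencesEqualTo⁻ p∈ₑ))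
                            l , x∈′ , y∈′ , _ = ∈-internalPairs⁻ (proj₁ (∈-differencesEqualTo⁻ p∈ᵢ))
                        in i≢j (trans (same-block {i} {l} x∈ x∈′) (same-block {l} {j} y∈′ y∈))

      proj₂∈ : ∀ {p} → p ∈ externals ++ internals → proj₂ p ∈ solutions 0 0 g
      proj₂∈ {x , y} p∈ = let x-sq , y-sq , y+g≡x = pair-squares p∈
                          in ∈-solutions⁺ 0<2 0<2 g y-sq (subst Square (sym y+g≡x) x-sq)

      shifted-pair∈ : ∀ i j {y} → y + g ∈ D i → y ∈ D j → (y + g , y) ∈ externals ++ internals
      shifted-pair∈ i j {y} y+g∈ y∈D = by-cases (i FinP.≟ j)
        where
        g≡difference : g ≡ y + g - y
        g≡difference = sym (y+g-y≡g y)
        y+g≢y : y + g ≢ y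
        y+g≢y y+g≡y = g≢0 (trans g≡difference (trans (cong (_- y) y+g≡y) (-‿inverseʳ y)))
        by-cases : Dec (i ≡ j) → (y + g , y) ∈ externals ++ internals
        by-cases (yes i≡j) = ∈-++⁺ʳ externals
          (∈-differencesEqualTo⁺ (∈-internalPairs⁺ {j} (subst (λ l → y + g ∈ D l) i≡j y+g∈) y∈D y+g≢y) g≡difference)
        by-cases (no i≢j)  = ∈-++⁺ˡ (∈-differencesEqualTo⁺ (∈-externalPairs⁺ {i} {j} i≢j y+g∈ y∈D) g≡difference)

      shifted∈ : ∀ {y} → y ∈ solutions 0 0 g → (y + g , y) ∈ externals ++ internals
      shifted∈ {y} y∈ =
        let y-sq , y+g-sq = ∈-solutions⁻ 0<2 0<2 g y∈
            i , y+g∈ = square⇒∈D y+g-sq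
            j , y∈D = square⇒∈D y-sq
        in shifted-pair∈ i j y+g∈ y∈D

    external+internal-count :
      length (differencesEqualTo g externalPairs) ℕ.+ length (differencesEqualTo g internalPairs)
        ≡ length (solutions 0 0 g)
    external+internal-count = begin
      length externals ℕ.+ length internals    ≡⟨ length-++ externals ⟨
      length (externals ++ internals)          ≡⟨ length-bijection unique-pairs (unique-solutions 0<2 0<2 g)
                                                    proj₂ (λ y → y + g , y) proj₂∈ shifted∈ (λ p∈ → cong (_, _) (proj₂ (proj₂ (pair-squares p∈)))) (λ _ → refl) ⟩
      length (solutions 0 0 g)                 ∎

  -- -1 = α^(2k) with n = 4k = e f, so -1 ∈ C_0^e exactly when f is even.
  -1∈C₀ᵉ : ∀ {f′} → f ≡ f′ ℕ.* 2 → InClass e 0 (- 1#)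
  -1∈C₀ᵉ {f′} f≡2f′ = k ℕ.* 2 , sym (α^m≡-1 {k ℕ.* 2} n≡2k*2) , trans (cong (_% e) 2k≡f′e) (m*n%n≡0 f′ e)
    where
    2k≡f′e : k ℕ.* 2 ≡ f′ ℕ.* e
    2k≡f′e = ℕP.*-cancelʳ-≡ _ _ 2 (begin
      k ℕ.* 2 ℕ.* 2       ≡⟨ n≡2k*2 ⟨
      n                   ≡⟨ n≡e*f ⟩
      e ℕ.* f             ≡⟨ cong (e ℕ.*_) f≡2f′ ⟩
      e ℕ.* (f′ ℕ.* 2)    ≡⟨ ℕP.*-assoc e f′ 2 ⟨
      e ℕ.* f′ ℕ.* 2      ≡⟨ cong (ℕ._* 2) (ℕP.*-comm e f′) ⟩
      f′ ℕ.* e ℕ.* 2      ∎)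

  -1∉C₀ᵉ : f % 2 ≡ 1 → ¬ InClass e 0 (- 1#)
  -1∉C₀ᵉ f%2≡1 (b , -1≡α^b , b%e≡0) = ℕP.0≢1+n (trans (sym f%2≡0) f%2≡1)
    where
    [2k]%e≡0 : (k ℕ.* 2) % e ≡ 0
    [2k]%e≡0 = trans (α^a≡α^b⇒a≡b[mod-d] e e∣n (trans (α^m≡-1 {k ℕ.* 2} n≡2k*2) -1≡α^b)) b%e≡0
    c : ℕ
    c = (k ℕ.* 2) / e
    2k≡ce : k ℕ.* 2 ≡ c ℕ.* e
    2k≡ce = trans (m≡m%n+[m/n]*n (k ℕ.* 2) e) (cong (ℕ._+ c ℕ.* e) [2k]%e≡0)
    f≡2c : f ≡ c ℕ.* 2
    f≡2c = ℕP.*-cancelˡ-≡ f (c ℕ.* 2) e (begin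
      e ℕ.* f            ≡⟨ n≡e*f ⟨
      n                  ≡⟨ n≡2k*2 ⟩
      k ℕ.* 2 ℕ.* 2      ≡⟨ cong (ℕ._* 2) 2k≡ce ⟩
      c ℕ.* e ℕ.* 2      ≡⟨ cong (ℕ._* 2) (ℕP.*-comm c e) ⟩
      e ℕ.* c ℕ.* 2      ≡⟨ ℕP.*-assoc e c 2 ⟩
      e ℕ.* (c ℕ.* 2)    ∎)
    f%2≡0 : f % 2 ≡ 0
    f%2≡0 = trans (cong (_% 2) f≡2c) (m*n%n≡0 c 2)

  private
    1⁻¹≡1 : 1# ⁻¹ ≡ 1#
    1⁻¹≡1 = ⁻¹-unique (*-identityˡ 1#)

    Φ-nonzero : ∀ {c t} (c<2 : c < 2) → t ∈ Φ c → t ≢ 0#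
    Φ-nonzero c<2 = InClass-nonzero e ∘ proj₁ ∘ ∈-Φ⁻ c<2

  -- t⁻¹ - 1 = -(t - 1) t⁻¹, and -1 and t⁻¹ are squares.
  ⁻¹-∈-Φ : ∀ {c t} (c<2 : c < 2) → t ∈ Φ c → t ⁻¹ ∈ Φ c
  ⁻¹-∈-Φ {c} {t} c<2 t∈ = ∈-Φ⁺ c<2 t⁻¹∈E
    (λ t⁻¹≡1 → t≢1 (trans (sym (⁻¹-involutive t≢0)) (trans (cong _⁻¹ t⁻¹≡1) 1⁻¹≡1)))
    (subst (InClass 2 c) t⁻¹-1≡-[t-1]*t⁻¹
      (InClass₂-*-square c<2 (-‿InClass₂ c<2 t-1∈) (InClass-weaken 2∣e t⁻¹∈E)))
    where
    t∈E : InClass e 0 t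
    t∈E = proj₁ (∈-Φ⁻ c<2 t∈)
    t≢1 : t ≢ 1#
    t≢1 = proj₁ (proj₂ (∈-Φ⁻ c<2 t∈))
    t-1∈ : InClass 2 c (t - 1#)
    t-1∈ = proj₂ (proj₂ (∈-Φ⁻ c<2 t∈))
    t≢0 : t ≢ 0#
    t≢0 = InClass-nonzero e t∈E
    t⁻¹∈E : InClass e 0 (t ⁻¹)
    t⁻¹∈E = subst (InClass e 0) (*-identityˡ _) (InClass-ratio e e∣n (0 , refl , m*n%n≡0 0 e) t∈E)
    t⁻¹-1≡-[t-1]*t⁻¹ : - (t - 1#) * t ⁻¹ ≡ t ⁻¹ - 1#
    t⁻¹-1≡-[t-1]*t⁻¹ = begin
      - (t - 1#) * t ⁻¹       ≡⟨ cong (_* t ⁻¹) (-‿anti-homo-- t 1#) ⟩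
      (1# - t) * t ⁻¹         ≡⟨ x*y⁻¹-1≡[x-y]*y⁻¹ t≢0 ⟨
      1# * t ⁻¹ - 1#          ≡⟨ cong (_- 1#) (*-identityˡ _) ⟩
      t ⁻¹ - 1#               ∎

  ⁻¹-fixed-in-Φ : ∀ {c t} (c<2 : c < 2) → t ∈ Φ c → t ⁻¹ ≡ t → t ≡ - 1#
  ⁻¹-fixed-in-Φ c<2 t∈ t⁻¹≡t = [ ⊥-elim ∘ proj₁ (proj₂ (∈-Φ⁻ c<2 t∈)) , id ]′
    (x²≡1⇒x≡±1 (trans (cong (_ *_) (sym t⁻¹≡t)) (x*x⁻¹≡1 (Φ-nonzero c<2 t∈))))

  φ₀+φ₁≡f∸1 : φ α e 0 ℕ.+ φ α e 1 ≡ f ℕ.∸ 1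
  φ₀+φ₁≡f∸1 = begin
    length (Φ 0) ℕ.+ length (Φ 1)              ≡⟨ length-++ (Φ 0) ⟨
    length (Φ 0 ++ Φ 1)                        ≡⟨ unique-length-≡ unique-Φ₀₁ (unique-remove _≟_ unique-E) (mk⇔ to from) ⟩
    length (remove _≟_ 1# (C α e 0))           ≡⟨ cong ℕ.pred (trans (length-remove _≟_ unique-E 1∈E) (length-C e {0} n≡e*f)) ⟩
    f ℕ.∸ 1                                    ∎
    where
    unique-E : Unique (C α e 0)
    unique-E = unique-C e e∣n (ℕ.>-nonZero⁻¹ e)
    1∈E : 1# ∈ C α e 0
    1∈E = InClass⇒∈C e e∣n (ℕ.>-nonZero⁻¹ e) (0 , refl , m*n%n≡0 0 e)
    unique-Φ₀₁ : Unique (Φ 0 ++ Φ 1)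
    unique-Φ₀₁ = Unique.++⁺ (unique-Φ 0<2) (unique-Φ 1<2)
      λ (t∈₀ , t∈₁) → ¬square∧nonSquare (proj₂ (proj₂ (∈-Φ⁻ 0<2 t∈₀))) (proj₂ (proj₂ (∈-Φ⁻ 1<2 t∈₁)))
    in-E∖1 : ∀ {c t} (c<2 : c < 2) → t ∈ Φ c → t ∈ remove _≟_ 1# (C α e 0)
    in-E∖1 c<2 t∈ = let t∈E , t≢1 , _ = ∈-Φ⁻ c<2 t∈
                    in ∈-remove⁺ _≟_ (InClass⇒∈C e e∣n (ℕ.>-nonZero⁻¹ e) t∈E) (t≢1 ∘ sym)
    to : ∀ {t} → t ∈ Φ 0 ++ Φ 1 → t ∈ remove _≟_ 1# (C α e 0)
    to t∈ = [ in-E∖1 0<2 , in-E∖1 1<2 ]′ (∈-++⁻ (Φ 0) t∈)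
    from : ∀ {t} → t ∈ remove _≟_ 1# (C α e 0) → t ∈ Φ 0 ++ Φ 1
    from {t} t∈ = let t∈E , 1≢t = ∈-remove⁻ _≟_ (C α e 0) t∈
                      t∈E′ = ∈C⇒InClass e (ℕ.>-nonZero⁻¹ e) t∈E
                  in [ ∈-++⁺ˡ ∘ ∈-Φ⁺ 0<2 t∈E′ (1≢t ∘ sym) , ∈-++⁺ʳ (Φ 0) ∘ ∈-Φ⁺ 1<2 t∈E′ (1≢t ∘ sym) ]′
                       (square⊎nonSquare (1≢t ∘ sym ∘ x-y≡0⇒x≡y t 1#))

  -- For odd f, t ↦ t⁻¹ is a fixed-point-free involution of Φ_c.
  φ-even : ∀ {c} → c < 2 → f % 2 ≡ 1 → ∃ λ x → φ α e c ≡ x ℕ.+ x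
  φ-even c<2 f%2≡1 = even-length-involution _≟_ _⁻¹ (unique-Φ c<2) (⁻¹-∈-Φ c<2)
    (⁻¹-involutive ∘ Φ-nonzero c<2)
    λ t∈ t⁻¹≡t → -1∉C₀ᵉ f%2≡1 (subst (InClass e 0) (⁻¹-fixed-in-Φ c<2 t∈ t⁻¹≡t) (proj₁ (∈-Φ⁻ c<2 t∈)))

  -- For even f and q ≡ 1 (mod 8), -1 is the only fixed point of t ↦ t⁻¹ on Φ_0.
  φ₀-odd : ∀ {f′ j} → f ≡ f′ ℕ.* 2 → n ≡ j ℕ.* 8 → ∃ λ x → φ α e 0 ≡ suc (x ℕ.+ x)
  φ₀-odd {f′} {j} f≡2f′ n≡8j = proj₁ pairs , trans (sym (length-remove _≟_ (unique-Φ 0<2) -1∈Φ₀)) (cong suc (proj₂ pairs))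
    where
    -1∈Φ₀ : - 1# ∈ Φ 0
    -1∈Φ₀ = ∈-Φ⁺ 0<2 (-1∈C₀ᵉ {f′} f≡2f′) (-1≢1 {k ℕ.* 2} n≡2k*2)
      (subst Square (trans (-1*x≈-x _) (sym (-x+-y≡-[x+y] 1# 1#))) (InClass-* 2 -1-square (2-square {j} n≡8j) refl))
    pairs : ∃ λ x → length (remove _≟_ (- 1#) (Φ 0)) ≡ x ℕ.+ x
    pairs = even-length-involution _≟_ _⁻¹ (unique-remove _≟_ (unique-Φ 0<2))
      (λ t∈′ → let t∈ , -1≢t = ∈-remove⁻ _≟_ (Φ 0) t∈′
               in ∈-remove⁺ _≟_ (⁻¹-∈-Φ 0<2 t∈) λ -1≡t⁻¹ → -1≢t (trans (sym -1⁻¹≡-1) (trans (cong _⁻¹ -1≡t⁻¹) (⁻¹-involutive (Φ-nonzero 0<2 t∈)))))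
      (⁻¹-involutive ∘ Φ-nonzero 0<2 ∘ proj₁ ∘ ∈-remove⁻ _≟_ (Φ 0))
      λ t∈′ t⁻¹≡t → let t∈ , -1≢t = ∈-remove⁻ _≟_ (Φ 0) t∈′ in -1≢t (sym (⁻¹-fixed-in-Φ 0<2 t∈ t⁻¹≡t))
      where
      -1⁻¹≡-1 : (- 1#) ⁻¹ ≡ - 1#
      -1⁻¹≡-1 = ⁻¹-unique (trans (-1*x≈-x (- 1#)) (-‿involutive 1#))

  nonSquare-outside-union : ∀ {g} → g ≢ 0# → ¬ InUnion D g → NonSquare g
  nonSquare-outside-union g≢0 g∉ with square⊎nonSquare g≢0
  ... | inj₁ g-sq  = ⊥-elim (g∉ (square⇒∈D g-sq))
  ... | inj₂ g-nsq = g-nsq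

  [q∸1]/4≡k : (order ℕ.∸ 1) / 4 ≡ k
  [q∸1]/4≡k = trans (cong (_/ 4) n≡k*4) (m*n/n≡m k 4)

  [q∸5]/4≡k∸1 : (order ℕ.∸ 5) / 4 ≡ k ℕ.∸ 1
  [q∸5]/4≡k∸1 = trans (cong (_/ 4) q∸5≡[k∸1]*4) (m*n/n≡m (k ℕ.∸ 1) 4)
    where
    q∸5≡[k∸1]*4 : order ℕ.∸ 5 ≡ (k ℕ.∸ 1) ℕ.* 4
    q∸5≡[k∸1]*4 = trans (sym (ℕP.∸-+-assoc order 1 4)) (trans (cong (ℕ._∸ 4) n≡k*4) (sym (ℕP.*-distribʳ-∸ 4 k 1)))

  isDisjointPDF : IsDisjointPDF (e / 2) f (ℤ.+ φ α e 0) (ℤ.+ φ α e 1) D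
  isDisjointPDF = isFamily , count-0-ΔDisj ,
    (λ g g≢0 (j , g∈) → cong ℤ.+_ (trans (count-ΔDisj g) (internal-count 0<2 (∈D⇒square j g∈)))) ,
    (λ g g≢0 g∉      → cong ℤ.+_ (trans (count-ΔDisj g) (internal-count 1<2 (nonSquare-outside-union g≢0 g∉))))

  isExternalPDF : IsExternalPDF (e / 2) f (ℤ.+ ((order ℕ.∸ 5) / 4) ℤ.- ℤ.+ φ α e 0)
                                          (ℤ.+ ((order ℕ.∸ 1) / 4) ℤ.- ℤ.+ φ α e 1) D
  isExternalPDF = isFamily , count-0-ΔExt ,
    (λ g g≢0 (j , g∈) → external-count g≢0 0<2 (∈D⇒square j g∈)
                          (trans (squares-shifted-by-square (∈D⇒square j g∈)) (sym [q∸5]/4≡k∸1))) ,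
    (λ g g≢0 g∉ → let g-nsq = nonSquare-outside-union g≢0 g∉ in
                  external-count g≢0 1<2 g-nsq (trans (squares-shifted-by-nonSquare g-nsq) (sym [q∸1]/4≡k)))
    where
    external-count : ∀ {c g N} → g ≢ 0# → c < 2 → InClass 2 c g → length (solutions 0 0 g) ≡ N →
                     ℤ.+ count g (ΔExt D) ≡ ℤ.+ N ℤ.- ℤ.+ φ α e c
    external-count {c} {g} {N} g≢0 c<2 g∈ N≡ =
      trans (cong ℤ.+_ (count-ΔExt g)) (trans (+a≡+[a+b]-+b ext (φ α e c)) (cong (λ w → ℤ.+ w ℤ.- ℤ.+ φ α e c) ext+φ≡N))
      where
      ext : ℕ
      ext = length (differencesEqualTo g externalPairs)
      ext+φ≡N : ext ℕ.+ φ α e c ≡ N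
      ext+φ≡N = trans (cong (ext ℕ.+_) (sym (internal-count c<2 g∈))) (trans (external+internal-count g≢0) N≡)

  φ₀≢φ₁×φ₁≢1+φ₀ : (order % 8 ≡ 1 × f % 4 ≡ 2) ⊎ f % 4 ≡ 3 → φ α e 0 ≢ φ α e 1 × φ α e 1 ≢ suc (φ α e 0)
  φ₀≢φ₁×φ₁≢1+φ₀ (inj₁ (order%8≡1 , f%4≡2)) =
    f≡2[mod4]⇒a≢b∧b≢1+a {f = f} f%4≡2 φ₀+φ₁≡f∸1 (φ₀-odd {f / 2} {order / 8} f≡[f/2]*2 (m∸1≡r+[m/d]*d {order} {8} order%8≡1))
    where
    f≡[f/2]*2 : f ≡ (f / 2) ℕ.* 2
    f≡[f/2]*2 = trans (m≡m%n+[m/n]*n f 2) (cong (ℕ._+ (f / 2) ℕ.* 2) (m%4≡r⇒m%2≡r%2 {f} f%4≡2))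
  φ₀≢φ₁×φ₁≢1+φ₀ (inj₂ f%4≡3) =
    f≡3[mod4]⇒a≢b∧b≢1+a {f = f} f%4≡3 φ₀+φ₁≡f∸1 (φ-even 0<2 f%2≡1) (φ-even 1<2 f%2≡1)
    where
    f%2≡1 : f % 2 ≡ 1
    f%2≡1 = m%4≡r⇒m%2≡r%2 {f} f%4≡3

  external-λ≢μ : φ α e 1 ≢ suc (φ α e 0) →
    ℤ.+ ((order ℕ.∸ 5) / 4) ℤ.- ℤ.+ φ α e 0 ≢ ℤ.+ ((order ℕ.∸ 1) / 4) ℤ.- ℤ.+ φ α e 1
  external-λ≢μ φ₁≢1+φ₀ λ≡μ = φ₁≢1+φ₀ (+a-+b≡+[1+a]-+c⇒c≡1+b (begin
    ℤ.+ (k ℕ.∸ 1) ℤ.- ℤ.+ φ α e 0                 ≡⟨ cong (λ w → ℤ.+ w ℤ.- ℤ.+ φ α e 0) [q∸5]/4≡k∸1 ⟨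
    ℤ.+ ((order ℕ.∸ 5) / 4) ℤ.- ℤ.+ φ α e 0       ≡⟨ λ≡μ ⟩
    ℤ.+ ((order ℕ.∸ 1) / 4) ℤ.- ℤ.+ φ α e 1       ≡⟨ cong (λ w → ℤ.+ w ℤ.- ℤ.+ φ α e 1) (trans [q∸1]/4≡k k≡1+[k∸1]) ⟩
    ℤ.+ suc (k ℕ.∸ 1) ℤ.- ℤ.+ φ α e 1             ∎))
    where
    k≡1+[k∸1] : k ≡ suc (k ℕ.∸ 1)
    k≡1+[k∸1] = sym (ℕP.suc-pred k {{ℕ.≢-nonZero λ k≡0 → ℕ.≢-nonZero⁻¹ n (trans n≡k*4 (cong (ℕ._* 4) k≡0))}})

theorem5p7 : (K : FiniteField) → let open FiniteField K in
    (e f : ℕ) (α : F) → IsPrimitive α →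
    IsPrimePower order → order ≡ e ℕ.* f ℕ.+ 1 → order ℕ.% 4 ≡ 1 →
    2 ℕ.< e → e ℕ.% 2 ≡ 0 → 1 ℕ.< f →
    ((order ℕ.% 8 ≡ 1 × f ℕ.% 4 ≡ 2) ⊎ f ℕ.% 4 ≡ 3) →
    IsProperDisjointPDF (e ℕ./ 2) f (ℤ.+ φ α e 0) (ℤ.+ φ α e 1)
      (λ (j : Fin (e ℕ./ 2)) → C α e (2 ℕ.* toℕ j))
    × IsProperExternalPDF (e ℕ./ 2) f
      (ℤ.+ ((order ℕ.∸ 5) ℕ./ 4) ℤ.- ℤ.+ φ α e 0)
      (ℤ.+ ((order ℕ.∸ 1) ℕ./ 4) ℤ.- ℤ.+ φ α e 1)
      (λ (j : Fin (e ℕ./ 2)) → C α e (2 ℕ.* toℕ j))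
theorem5p7 K e f α α-primitive _ order≡ef+1 order%4≡1 _ e%2≡0 _ cases =
  (isDisjointPDF , φ₀≢φ₁ ∘ ℤP.+-injective) , (isExternalPDF , external-λ≢μ φ₁≢1+φ₀)
  where
  open SquareFamily K α α-primitive e f order≡ef+1 order%4≡1 e%2≡0
  φ₀≢φ₁ : φ α e 0 ≢ φ α e 1
  φ₀≢φ₁ = proj₁ (φ₀≢φ₁×φ₁≢1+φ₀ cases)
  φ₁≢1+φ₀ : φ α e 1 ≢ suc (φ α e 0)
  φ₁≢1+φ₀ = proj₂ (φ₀≢φ₁×φ₁≢1+φ₀ cases)
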